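{- Let $2\le k\le n-2$ and $r=n-k$. Then $$\widetilde\chi(\Delta_k(P_n^2))=(-1)^{r-1}\left(\binom{n-1}{k-1}-\sum_{j=0}^{\min\{k-1,r\}}\binom{k-1}{j}(r-j+1)+r\right).$$
   Context: For a finite simple graph $G$ on $[n]=\{1,\dots,n\}$ and $2\le k\le n$, the $k$-cut complex $\Delta_k(G)$ is the simplicial complex on $[n]$ whose facets are the sets $[n]\setminus T$, where $T$ ranges over the $k$-element subsets of $[n]$ with $G[T]$ disconnected. The squared path $P_n^2$ is the graph on $[n]$ whose edges are the pairs $\{i,i+1\}$ ($1\le i\le n-1$) and $\{i,i+2\}$ ($1\le i\le n-2$). The reduced Euler characteristic of a simplicial complex $\Delta$ is $\widetilde\chi(\Delta)=\sum_{F\in\Delta}(-1)^{|F|-1}$, the sum including the empty face. -}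

module Defs where

open import Data.Bool using (Bool; true; false; _∧_; _∨_; not; if_then_else_)
open import Data.Nat as ℕ using (ℕ; zero; suc; _≡ᵇ_)
open import Data.Fin using (Fin; toℕ)
open import Data.Fin.Subset using (Subset; ∣_∣; _∩_; _─_; ⊥)
open import Data.Vec using (Vec; []; _∷_; lookup)
open import Data.List using (List; []; _∷_; map; _++_; filter; foldr)
open import Data.Bool.ListAction using (any; all)
open import Data.List as L using ()
open import Data.Integer as ℤ using (ℤ; +_; -_)
open import Function using (_∘_)

-- A finite simple graph on the vertex set Fin n (vertex i stands for i+1 ∈ [n]),
-- given by its (Boolean, decidable) adjacency relation.
Graph : ℕ → Set
Graph n = Fin n → Fin n → Bool

absDiff : ℕ → ℕ → ℕ
absDiff a b = (a ℕ.∸ b) ℕ.+ (b ℕ.∸ a)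

Psq : (n : ℕ) → Graph n
Psq n i j = (absDiff (toℕ i) (toℕ j) ≡ᵇ 1) ∨ (absDiff (toℕ i) (toℕ j) ≡ᵇ 2)

allSubsets : (n : ℕ) → List (Subset n)
allSubsets zero = [] ∷ []
allSubsets (suc n) = map (true ∷_) (allSubsets n) ++ map (false ∷_) (allSubsets n)

_∈ᵇ_ : {n : ℕ} → Fin n → Subset n → Bool
i ∈ᵇ S = lookup S i

allFinList : (n : ℕ) → List (Fin n)
allFinList n = L.allFin n

isEmptyᵇ : {n : ℕ} → Subset n → Bool
isEmptyᵇ {n} S = all (λ i → not (i ∈ᵇ S)) (allFinList n)

noEdgeBetween : {n : ℕ} → Graph n → Subset n → Subset n → Bool
noEdgeBetween {n} G A B =
  all (λ i → all (λ j → not (i ∈ᵇ A ∧ j ∈ᵇ B ∧ G i j)) (allFinList n)) (allFinList n)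

_⊆ᵇ_ : {n : ℕ} → Subset n → Subset n → Bool
_⊆ᵇ_ {n} A T = all (λ i → not (i ∈ᵇ A) ∨ (i ∈ᵇ T)) (allFinList n)

disconnectedᵇ : {n : ℕ} → Graph n → Subset n → Bool
disconnectedᵇ {n} G T =
  any (λ A → (A ⊆ᵇ T) ∧ not (isEmptyᵇ A) ∧ not (isEmptyᵇ (T ─ A))
             ∧ noEdgeBetween G A (T ─ A))
      (allSubsets n)

Complex : ℕ → Set
Complex n = Subset n → Bool

disjointᵇ : {n : ℕ} → Subset n → Subset n → Bool
disjointᵇ F T = isEmptyᵇ (F ∩ T)

-- The k-cut complex Δ_k(G): facets are [n] ∖ T with |T| = k and G[T]
-- disconnected; so F is a face iff F ⊆ [n] ∖ T (i.e. F ∩ T = ∅) for such a T.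
cutComplex : {n : ℕ} → Graph n → ℕ → Complex n
cutComplex {n} G k F =
  any (λ T → (∣ T ∣ ≡ᵇ k) ∧ disconnectedᵇ G T ∧ disjointᵇ F T) (allSubsets n)

-- (-1)^(m-1) as an integer, with (-1)^(-1) = -1 (used for the empty face)
signPred : ℕ → ℤ
signPred m = - ((ℤ.-[1+ 0 ]) ℤ.^ m)

sumℤ : List ℤ → ℤ
sumℤ = foldr ℤ._+_ (+ 0)

redEuler : {n : ℕ} → Complex n → ℤ
redEuler {n} Δ = sumℤ (map (signPred ∘ ∣_∣) (filter (λ F → Δ F Data.Bool.≟ true) (allSubsets n)))
  where import Data.Bool

-- A vertex set T of P_n^2 induces a disconnected graph exactly when two consecutive
-- positions c + 1, c + 2 are missing from T between two of its members (a gap). So F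
-- is a face of Δ_k(P_n^2) iff its complement U contains a k-set with a gap, which
-- fails exactly when |U| < k, when |U| = k and U has no gap, or when U is an interval
-- of k + 1 positions. Summing over complements, χ̃ = (-1)^n Σ (-1)^|U| over these U:
-- the sets with |U| < k give (-1)^(k-1) C(n-1, k-1), the gap-free k-sets number
-- Σ_j C(k-1, j) (n-k-j+1) (choose which j of the k-1 consecutive differences are 2),
-- and there are n - k intervals of k + 1 positions.
module Submission where

open import Defs
open import Data.Bool using (Bool; true; false; _∧_; _∨_; not; if_then_else_)
open import Data.Bool.Properties
  using (T-≡; ∨-zeroʳ; ∧-zeroʳ; ∧-identityʳ; ∧-conicalˡ; ∧-conicalʳ; ∨-conicalˡ; ∨-conicalʳ)
open import Data.Bool.ListAction using (any; all)
open import Data.Nat using (ℕ; zero; suc; _≤_; _<_; _+_; _*_; _∸_; z≤n; s≤s; _≡ᵇ_; _<ᵇ_; _≟_; _≤?_; _<?_; _⊓_)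
import Data.Nat.Properties as ℕ
open import Data.Fin using (Fin; toℕ; fromℕ<)
open import Data.Fin.Properties using (toℕ-fromℕ<)
open import Data.Fin.Subset using (Subset; ∣_∣; _∩_; _∪_; _─_; ∁; ⊥)
open import Data.Fin.Subset.Properties using (∣⊥∣≡0; ∣p∣≤∣x∷p∣; ∣p∣≤n; ∣∁p∣≡n∸∣p∣)
open import Data.Vec using ([]; _∷_; lookup)
open import Data.List using (List; []; _∷_; _++_; map; filter; upTo; applyUpTo)
open import Data.List.Properties using (map-++; map-∘)
open import Data.Nat.Combinatorics using (_C_; nCk+nC[k+1]≡[n+1]C[k+1]; k>n⇒nCk≡0)
open import Data.Integer using (ℤ; +_; 0ℤ; 1ℤ; -1ℤ; -[1+_])
import Data.Integer as ℤ
import Data.Integer.Properties as ℤₚ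
import Data.Integer.Tactic.RingSolver as ℤ-Ring
import Data.Nat.Tactic.RingSolver as ℕ-Ring
import Data.Bool as Bool
open import Algebra.Properties.CommutativeSemigroup ℕ.+-commutativeSemigroup
  using () renaming (interchange to +-interchange)
open import Algebra.Properties.CommutativeSemigroup ℤₚ.+-commutativeSemigroup
  using () renaming (interchange to +ℤ-interchange)
open import Data.List.Membership.Propositional using (_∈_; lose)
open import Data.List.Membership.Propositional.Properties using (∈-allFin; ∈-map⁺; ∈-++⁺ˡ; ∈-++⁺ʳ)
open import Data.List.Relation.Unary.Any using (here; satisfied)
open import Data.List.Relation.Unary.Any.Properties using (any⁺; any⁻)
import Data.List.Relation.Unary.All as All
open import Data.List.Relation.Unary.All.Properties using (all⁺; all⁻)
open import Data.Product using (∃; _×_; _,_; proj₁; proj₂)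
open import Data.Sum using (_⊎_; inj₁; inj₂)
open import Data.Empty using (⊥-elim)
open import Function using (_∘_; Equivalence)
open import Relation.Nullary using (¬_; yes; no; contradiction)
open import Relation.Nullary.Decidable using (dec-true; dec-false)
open import Relation.Binary.Definitions using (tri<; tri≈; tri>)
open import Relation.Binary.PropositionalEquality hiding ([_])

private
  variable
    n : ℕ

bool-clash : ∀ {b} {A : Set} → b ≡ true → b ≡ false → A
bool-clash refl ()

not≡true : ∀ {b} → not b ≡ true → b ≡ false
not≡true {false} _ = refl

∧≡false : ∀ {a b} → (a ≡ true → b ≡ false) → (a ∧ b) ≡ false
∧≡false {false} _ = refl
∧≡false {true}  h = h refl

∧≡false⁻ : ∀ {a b} → (a ∧ b) ≡ false → a ≡ true → b ≡ false
∧≡false⁻ e refl = e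

<ᵇ-true : ∀ {m n} → m < n → (m <ᵇ n) ≡ true
<ᵇ-true {m} {n} = dec-true (m <? n)

<ᵇ-false : ∀ {m n} → ¬ m < n → (m <ᵇ n) ≡ false
<ᵇ-false {m} {n} = dec-false (m <? n)

≡ᵇ-true : ∀ {m n} → m ≡ n → (m ≡ᵇ n) ≡ true
≡ᵇ-true {m} {n} = dec-true (m ≟ n)

≡ᵇ-false : ∀ {m n} → m ≢ n → (m ≡ᵇ n) ≡ false
≡ᵇ-false {m} {n} = dec-false (m ≟ n)

≡ᵇ≡true⇒≡ : ∀ {m n} → (m ≡ᵇ n) ≡ true → m ≡ n
≡ᵇ≡true⇒≡ {m} {n} e = ℕ.≡ᵇ⇒≡ m n (Equivalence.from T-≡ e)

module _ {A : Set} (p : A → Bool) where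

  any≡true⁺ : ∀ {x xs} → x ∈ xs → p x ≡ true → any p xs ≡ true
  any≡true⁺ x∈xs px = Equivalence.to T-≡ (any⁺ p (lose x∈xs (Equivalence.from T-≡ px)))

  any≡true⁻ : ∀ xs → any p xs ≡ true → ∃ λ x → p x ≡ true
  any≡true⁻ xs e with satisfied (any⁻ p xs (Equivalence.from T-≡ e))
  ... | x , px = x , Equivalence.to T-≡ px

  all≡true⁺ : ∀ xs → (∀ x → p x ≡ true) → all p xs ≡ true
  all≡true⁺ xs h = Equivalence.to T-≡ (all⁻ p (All.universal (λ x → Equivalence.from T-≡ (h x)) xs))

  all≡true⁻ : ∀ {x xs} → all p xs ≡ true → x ∈ xs → p x ≡ true
  all≡true⁻ {xs = xs} e x∈xs = Equivalence.to T-≡ (All.lookup (all⁺ p xs (Equivalence.from T-≡ e)) x∈xs)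

-- Subsets of Fin n are read through natural-number positions, as P_n^2 is:
-- position x stands for the vertex x + 1, and positions ≥ n are never members.
mem : Subset n → ℕ → Bool
mem []      _       = false
mem (b ∷ S) zero    = b
mem (b ∷ S) (suc x) = mem S x

lookup≡mem : (S : Subset n) (i : Fin n) → lookup S i ≡ mem S (toℕ i)
lookup≡mem (b ∷ S) Fin.zero    = refl
lookup≡mem (b ∷ S) (Fin.suc i) = lookup≡mem S i

lookup-fromℕ< : (S : Subset n) {x : ℕ} (x<n : x < n) → lookup S (fromℕ< x<n) ≡ mem S x
lookup-fromℕ< S x<n = trans (lookup≡mem S _) (cong (mem S) (toℕ-fromℕ< x<n))

mem⇒< : (S : Subset n) (x : ℕ) → mem S x ≡ true → x < n
mem⇒< (b ∷ S) zero    _ = s≤s z≤n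
mem⇒< (b ∷ S) (suc x) e = s≤s (mem⇒< S x e)

mem-⊥ : ∀ n x → mem (⊥ {n}) x ≡ false
mem-⊥ zero    x       = refl
mem-⊥ (suc n) zero    = refl
mem-⊥ (suc n) (suc x) = mem-⊥ n x

mem-∩ : (S T : Subset n) (x : ℕ) → mem (S ∩ T) x ≡ mem S x ∧ mem T x
mem-∩ []      []      x       = refl
mem-∩ (a ∷ S) (b ∷ T) zero    = refl
mem-∩ (a ∷ S) (b ∷ T) (suc x) = mem-∩ S T x

mem-∪ : (S T : Subset n) (x : ℕ) → mem (S ∪ T) x ≡ mem S x ∨ mem T x
mem-∪ []      []      x       = refl
mem-∪ (a ∷ S) (b ∷ T) zero    = refl
mem-∪ (a ∷ S) (b ∷ T) (suc x) = mem-∪ S T x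

mem-─ : (S T : Subset n) (x : ℕ) → mem (S ─ T) x ≡ mem S x ∧ not (mem T x)
mem-─ []          []          x       = refl
mem-─ (true  ∷ S) (true  ∷ T) zero    = refl
mem-─ (false ∷ S) (true  ∷ T) zero    = refl
mem-─ (true  ∷ S) (false ∷ T) zero    = refl
mem-─ (false ∷ S) (false ∷ T) zero    = refl
mem-─ (a ∷ S)     (b ∷ T)     (suc x) = mem-─ S T x

mem-∁ : (S : Subset n) (x : ℕ) → x < n → mem (∁ S) x ≡ not (mem S x)
mem-∁ (b ∷ S) zero    _         = refl
mem-∁ (b ∷ S) (suc x) (s≤s x<n) = mem-∁ S x x<n

≤∧∉⇒< : (T : Subset n) {a y : ℕ} → mem T y ≡ true → mem T a ≡ false → a ≤ y → a < y
≤∧∉⇒< T y∈T a∉T a≤y = ℕ.≤∧≢⇒< a≤y λ { refl → bool-clash y∈T a∉T }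

mem-∩⁻ˡ : (A B : Subset n) {x : ℕ} → mem (A ∩ B) x ≡ true → mem A x ≡ true
mem-∩⁻ˡ A B {x} e = ∧-conicalˡ _ _ (trans (sym (mem-∩ A B x)) e)

mem-∩⁻ʳ : (A B : Subset n) {x : ℕ} → mem (A ∩ B) x ≡ true → mem B x ≡ true
mem-∩⁻ʳ A B {x} e = ∧-conicalʳ (mem A x) _ (trans (sym (mem-∩ A B x)) e)

mem-∪⁺ˡ : (A B : Subset n) {x : ℕ} → mem A x ≡ true → mem (A ∪ B) x ≡ true
mem-∪⁺ˡ A B {x} x∈A rewrite mem-∪ A B x | x∈A = refl

mem-∪⁺ʳ : (A B : Subset n) {x : ℕ} → mem B x ≡ true → mem (A ∪ B) x ≡ true
mem-∪⁺ʳ A B {x} x∈B rewrite mem-∪ A B x | x∈B | ∨-zeroʳ (mem A x) = refl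

mem-∪⁻ : (A B : Subset n) {x : ℕ} → mem (A ∪ B) x ≡ true → mem A x ≡ true ⊎ mem B x ≡ true
mem-∪⁻ A B {x} e with mem A x in x∈A
... | true  = inj₁ refl
... | false = inj₂ (trans (sym (cong (_∨ mem B x) x∈A)) (trans (sym (mem-∪ A B x)) e))

mem-∪≡false⁻ : (A B : Subset n) {x : ℕ} → mem (A ∪ B) x ≡ false → mem A x ≡ false × mem B x ≡ false
mem-∪≡false⁻ A B {x} e = let e′ = trans (sym (mem-∪ A B x)) e in ∨-conicalˡ _ _ e′ , ∨-conicalʳ (mem A x) _ e′

mem-─⁺ : (S T : Subset n) {x : ℕ} → mem S x ≡ true → mem T x ≡ false → mem (S ─ T) x ≡ true
mem-─⁺ S T {x} x∈S x∉T rewrite mem-─ S T x | x∈S | x∉T = refl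

mem-─⁻ˡ : (S T : Subset n) {x : ℕ} → mem (S ─ T) x ≡ true → mem S x ≡ true
mem-─⁻ˡ S T {x} e = ∧-conicalˡ _ _ (trans (sym (mem-─ S T x)) e)

mem-─⁻ʳ : (S T : Subset n) {x : ℕ} → mem (S ─ T) x ≡ true → mem T x ≡ false
mem-─⁻ʳ S T {x} e = not≡true (∧-conicalʳ _ _ (trans (sym (mem-─ S T x)) e))

mem-─-∉ : (U X : Subset n) {x : ℕ} → (mem U x ≡ true → mem X x ≡ true) → mem (U ─ X) x ≡ false
mem-─-∉ U X {x} U⇒X rewrite mem-─ U X x with mem U x in x∈U
... | false = refl
... | true  rewrite U⇒X refl = refl

∁⁺ : (F : Subset n) {x : ℕ} → x < n → mem F x ≡ false → mem (∁ F) x ≡ true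
∁⁺ F {x} x<n x∉F rewrite mem-∁ F x x<n | x∉F = refl

∁⁻ : (F : Subset n) {x : ℕ} → mem (∁ F) x ≡ true → mem F x ≡ false
∁⁻ F {x} e = not≡true (trans (sym (mem-∁ F x (mem⇒< (∁ F) x e))) e)

∁-involutive : (U : Subset n) → ∁ (∁ U) ≡ U
∁-involutive []          = refl
∁-involutive (true ∷ U)  = cong (true ∷_) (∁-involutive U)
∁-involutive (false ∷ U) = cong (false ∷_) (∁-involutive U)

_⊆_ : Subset n → Subset n → Set
S ⊆ T = ∀ {x} → mem S x ≡ true → mem T x ≡ true

⊆-∉ : (A B : Subset n) → A ⊆ B → ∀ {x} → mem B x ≡ false → mem A x ≡ false
⊆-∉ A B A⊆B {x} x∉B with mem A x in x∈A
... | false = refl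
... | true  = bool-clash (A⊆B x∈A) x∉B

member? : (S : Subset n) → (∃ λ x → mem S x ≡ true) ⊎ (∀ x → mem S x ≡ false)
member? []          = inj₂ λ _ → refl
member? (true ∷ S)  = inj₁ (0 , refl)
member? (false ∷ S) with member? S
... | inj₁ (x , x∈S) = inj₁ (suc x , x∈S)
... | inj₂ none      = inj₂ λ { zero → refl ; (suc x) → none x }

least : (S : Subset n) {x : ℕ} → mem S x ≡ true →
        ∃ λ t → mem S t ≡ true × ∀ {y} → mem S y ≡ true → t ≤ y
least (true ∷ S)            _   = 0 , refl , λ _ → z≤n
least (false ∷ S) {suc x} x∈S with least S x∈S
... | t , t∈S , t≤ = suc t , t∈S , λ { {suc y} y∈S → s≤s (t≤ y∈S) }

⁅_⁆ : ℕ → Subset n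
⁅_⁆ {zero}  _       = []
⁅_⁆ {suc n} zero    = true ∷ ⊥
⁅_⁆ {suc n} (suc a) = false ∷ ⁅ a ⁆

mem-⁅⁆⁺ : ∀ {a} → a < n → mem (⁅_⁆ {n} a) a ≡ true
mem-⁅⁆⁺ {suc n} {zero}  _         = refl
mem-⁅⁆⁺ {suc n} {suc a} (s≤s a<n) = mem-⁅⁆⁺ a<n

mem-⁅⁆⁻ : ∀ {a x} → mem (⁅_⁆ {n} a) x ≡ true → x ≡ a
mem-⁅⁆⁻ {suc n} {zero}  {zero}  _ = refl
mem-⁅⁆⁻ {suc n} {zero}  {suc x} e = bool-clash e (mem-⊥ n x)
mem-⁅⁆⁻ {suc n} {suc a} {suc x} e = cong suc (mem-⁅⁆⁻ {n} e)

mem-⁅⁆-≢ : ∀ {a x} → x ≢ a → mem (⁅_⁆ {n} a) x ≡ false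
mem-⁅⁆-≢ {n} {a} {x} x≢a with mem (⁅_⁆ {n} a) x in e
... | false = refl
... | true  = contradiction (mem-⁅⁆⁻ {n} e) x≢a

mem-⁅⁆≡false⇒≢ : ∀ {a x} → x < n → mem (⁅_⁆ {n} a) x ≡ false → x ≢ a
mem-⁅⁆≡false⇒≢ x<n x∉a refl = bool-clash (mem-⁅⁆⁺ x<n) x∉a

atMost : ℕ → Subset n
atMost {zero}  _       = []
atMost {suc n} zero    = true ∷ ⊥
atMost {suc n} (suc c) = true ∷ atMost c

atMost⁺ : ∀ {x c} → x < n → x ≤ c → mem (atMost {n} c) x ≡ true
atMost⁺ {suc n} {zero}  {zero}  _ _ = refl
atMost⁺ {suc n} {zero}  {suc c} _ _ = refl
atMost⁺ {suc n} {suc x} {suc c} (s≤s x<n) (s≤s x≤c) = atMost⁺ x<n x≤c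

atMost⁻ : ∀ {x c} → mem (atMost {n} c) x ≡ true → x ≤ c
atMost⁻ {suc n} {zero}           _ = z≤n
atMost⁻ {suc n} {suc x} {zero}  e = bool-clash e (mem-⊥ n x)
atMost⁻ {suc n} {suc x} {suc c} e = s≤s (atMost⁻ {n} e)

empty? : Subset n → Bool
empty? []          = true
empty? (true ∷ S)  = false
empty? (false ∷ S) = empty? S

empty?≡false⁺ : (S : Subset n) {x : ℕ} → mem S x ≡ true → empty? S ≡ false
empty?≡false⁺ (true ∷ S)            _   = refl
empty?≡false⁺ (false ∷ S) {suc x} x∈S = empty?≡false⁺ S x∈S

empty?≡false⁻ : (S : Subset n) → empty? S ≡ false → ∃ λ x → mem S x ≡ true
empty?≡false⁻ (true ∷ S)  _ = 0 , refl
empty?≡false⁻ (false ∷ S) e with empty?≡false⁻ S e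
... | x , x∈S = suc x , x∈S

empty?-⊥ : ∀ n → empty? (⊥ {n}) ≡ true
empty?-⊥ zero    = refl
empty?-⊥ (suc n) = empty?-⊥ n

∈-allSubsets : (S : Subset n) → S ∈ allSubsets n
∈-allSubsets []                = here refl
∈-allSubsets {suc n} (true ∷ S)  = ∈-++⁺ˡ (∈-map⁺ (true ∷_) (∈-allSubsets S))
∈-allSubsets {suc n} (false ∷ S) =
  ∈-++⁺ʳ (map (true ∷_) (allSubsets n)) (∈-map⁺ (false ∷_) (∈-allSubsets S))

∣⁅⁆∣≤1 : ∀ a → ∣ ⁅_⁆ {n} a ∣ ≤ 1
∣⁅⁆∣≤1 {zero}  _       = z≤n
∣⁅⁆∣≤1 {suc n} zero    = s≤s (ℕ.≤-reflexive (∣⊥∣≡0 n))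
∣⁅⁆∣≤1 {suc n} (suc a) = ∣⁅⁆∣≤1 {n} a

∣∪∣≤ : (A B : Subset n) → ∣ A ∪ B ∣ ≤ ∣ A ∣ + ∣ B ∣
∣∪∣≤ []          []          = z≤n
∣∪∣≤ (true ∷ A)  (true ∷ B)  = s≤s (ℕ.≤-trans (∣∪∣≤ A B) (ℕ.≤-trans (ℕ.n≤1+n _) (ℕ.≤-reflexive (sym (ℕ.+-suc _ _)))))
∣∪∣≤ (true ∷ A)  (false ∷ B) = s≤s (∣∪∣≤ A B)
∣∪∣≤ (false ∷ A) (true ∷ B)  = ℕ.≤-trans (s≤s (∣∪∣≤ A B)) (ℕ.≤-reflexive (sym (ℕ.+-suc _ _)))
∣∪∣≤ (false ∷ A) (false ∷ B) = ∣∪∣≤ A B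

∣⁅⁆∪⁅⁆∣≤2 : ∀ a b → ∣ ⁅_⁆ {n} a ∪ ⁅ b ⁆ ∣ ≤ 2
∣⁅⁆∪⁅⁆∣≤2 {n} a b = ℕ.≤-trans (∣∪∣≤ {n} ⁅ a ⁆ ⁅ b ⁆) (ℕ.+-mono-≤ (∣⁅⁆∣≤1 {n} a) (∣⁅⁆∣≤1 {n} b))

∣⊆∣ : (A B : Subset n) → A ⊆ B → ∣ A ∣ ≤ ∣ B ∣
∣⊆∣ []          []          _   = z≤n
∣⊆∣ (true ∷ A)  (true ∷ B)  A⊆B = s≤s (∣⊆∣ A B (λ {x} → A⊆B {suc x}))
∣⊆∣ (true ∷ A)  (false ∷ B) A⊆B = contradiction (A⊆B {0} refl) λ ()
∣⊆∣ (false ∷ A) (true ∷ B)  A⊆B = ℕ.m≤n⇒m≤1+n (∣⊆∣ A B (λ {x} → A⊆B {suc x}))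
∣⊆∣ (false ∷ A) (false ∷ B) A⊆B = ∣⊆∣ A B (λ {x} → A⊆B {suc x})

∣⊂∣ : (A B : Subset n) → A ⊆ B → ∀ {x} → mem B x ≡ true → mem A x ≡ false → ∣ A ∣ < ∣ B ∣
∣⊂∣ (false ∷ A) (true ∷ B)  A⊆B {zero}  _   _   = s≤s (∣⊆∣ A B (λ {x} → A⊆B {suc x}))
∣⊂∣ (true ∷ A)  (true ∷ B)  A⊆B {suc x} x∈B x∉A = s≤s (∣⊂∣ A B (λ {x} → A⊆B {suc x}) x∈B x∉A)
∣⊂∣ (true ∷ A)  (false ∷ B) A⊆B {suc x} _   _   = contradiction (A⊆B {0} refl) λ ()
∣⊂∣ (false ∷ A) (true ∷ B)  A⊆B {suc x} x∈B x∉A = ℕ.m≤n⇒m≤1+n (∣⊂∣ A B (λ {x} → A⊆B {suc x}) x∈B x∉A)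
∣⊂∣ (false ∷ A) (false ∷ B) A⊆B {suc x} x∈B x∉A = ∣⊂∣ A B (λ {x} → A⊆B {suc x}) x∈B x∉A

∣⊂∣₂ : (A B : Subset n) → A ⊆ B → ∀ {x y} → x < y → mem B x ≡ true → mem A x ≡ false →
       mem B y ≡ true → mem A y ≡ false → 2 + ∣ A ∣ ≤ ∣ B ∣
∣⊂∣₂ (false ∷ A) (true ∷ B)  A⊆B {zero}  {suc y} _         _   _   y∈B y∉A =
  s≤s (∣⊂∣ A B (λ {x} → A⊆B {suc x}) y∈B y∉A)
∣⊂∣₂ (true ∷ A)  (true ∷ B)  A⊆B {suc x} {suc y} (s≤s x<y) x∈B x∉A y∈B y∉A =
  s≤s (∣⊂∣₂ A B (λ {x} → A⊆B {suc x}) x<y x∈B x∉A y∈B y∉A)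
∣⊂∣₂ (true ∷ A)  (false ∷ B) A⊆B {suc x} {suc y} _         _   _   _   _   =
  contradiction (A⊆B {0} refl) λ ()
∣⊂∣₂ (false ∷ A) (true ∷ B)  A⊆B {suc x} {suc y} (s≤s x<y) x∈B x∉A y∈B y∉A =
  ℕ.m≤n⇒m≤1+n (∣⊂∣₂ A B (λ {x} → A⊆B {suc x}) x<y x∈B x∉A y∈B y∉A)
∣⊂∣₂ (false ∷ A) (false ∷ B) A⊆B {suc x} {suc y} (s≤s x<y) x∈B x∉A y∈B y∉A =
  ∣⊂∣₂ A B (λ {x} → A⊆B {suc x}) x<y x∈B x∉A y∈B y∉A

∣─∣+∣∩∣ : (U X : Subset n) → ∣ U ─ X ∣ + ∣ U ∩ X ∣ ≡ ∣ U ∣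
∣─∣+∣∩∣ []          []          = refl
∣─∣+∣∩∣ (true ∷ U)  (true ∷ X)  = trans (ℕ.+-suc _ _) (cong suc (∣─∣+∣∩∣ U X))
∣─∣+∣∩∣ (true ∷ U)  (false ∷ X) = cong suc (∣─∣+∣∩∣ U X)
∣─∣+∣∩∣ (false ∷ U) (true ∷ X)  = ∣─∣+∣∩∣ U X
∣─∣+∣∩∣ (false ∷ U) (false ∷ X) = ∣─∣+∣∩∣ U X

∃-outside : (X V : Subset n) → ∣ X ∣ < ∣ V ∣ → ∃ λ j → mem V j ≡ true × mem X j ≡ false
∃-outside (false ∷ X) (true ∷ V)  _   = 0 , refl , refl
∃-outside (true ∷ X)  (true ∷ V)  (s≤s X<V) with ∃-outside X V X<V
... | j , j∈V , j∉X = suc j , j∈V , j∉X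
∃-outside (x ∷ X)     (false ∷ V) X<V with ∃-outside X V (ℕ.≤-trans (s≤s (∣p∣≤∣x∷p∣ x X)) X<V)
... | j , j∈V , j∉X = suc j , j∈V , j∉X

extend : (K V : Subset n) (k : ℕ) → K ⊆ V → ∣ K ∣ ≤ k → k ≤ ∣ V ∣ →
         ∃ λ T → K ⊆ T × T ⊆ V × ∣ T ∣ ≡ k
extend []          []          zero    _   _         _         = [] , (λ e → e) , (λ e → e) , refl
extend (true ∷ K)  (false ∷ V) k       K⊆V _         _         = contradiction (K⊆V {0} refl) λ ()
extend (true ∷ K)  (true ∷ V)  (suc k) K⊆V (s≤s K≤k) (s≤s k≤V)
  with extend K V k (λ {x} → K⊆V {suc x}) K≤k k≤V
... | T , K⊆T , T⊆V , ∣T∣≡k =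
  true ∷ T , (λ { {zero} _ → refl ; {suc x} → K⊆T }) , (λ { {zero} _ → refl ; {suc x} → T⊆V }) , cong suc ∣T∣≡k
extend (false ∷ K) (false ∷ V) k       K⊆V K≤k       k≤V
  with extend K V k (λ {x} → K⊆V {suc x}) K≤k k≤V
... | T , K⊆T , T⊆V , ∣T∣≡k =
  false ∷ T , (λ { {zero} () ; {suc x} → K⊆T }) , (λ { {zero} () ; {suc x} → T⊆V }) , ∣T∣≡k
extend (false ∷ K) (true ∷ V)  k       K⊆V K≤k       k≤1+V with k ≤? ∣ V ∣
... | no  k≰V = true ∷ V , (λ {x} → K⊆V {x}) , (λ e → e) , ℕ.≤-antisym (ℕ.≰⇒> k≰V) k≤1+V
... | yes k≤V with extend K V k (λ {x} → K⊆V {suc x}) K≤k k≤V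
...   | T , K⊆T , T⊆V , ∣T∣≡k =
  false ∷ T , (λ { {zero} () ; {suc x} → K⊆T }) , (λ { {zero} () ; {suc x} → T⊆V }) , ∣T∣≡k

-- Psq n i j unfolds to adjacent (toℕ i) (toℕ j).
adjacent : ℕ → ℕ → Bool
adjacent a b = (absDiff a b ≡ᵇ 1) ∨ (absDiff a b ≡ᵇ 2)

module _ {n : ℕ} where

  isEmptyᵇ⁺ : (S : Subset n) → (∀ x → mem S x ≡ false) → isEmptyᵇ S ≡ true
  isEmptyᵇ⁺ S h = all≡true⁺ _ (allFinList n) λ i → cong not (trans (lookup≡mem S i) (h (toℕ i)))

  isEmptyᵇ⁻ : (S : Subset n) → isEmptyᵇ S ≡ true → ∀ x → mem S x ≡ false
  isEmptyᵇ⁻ S e x with mem S x in x∈S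
  ... | false = refl
  ... | true  = bool-clash (all≡true⁻ (λ i → not (lookup S i)) e (∈-allFin _))
                           (cong not (trans (lookup-fromℕ< S x<n) x∈S))
    where x<n = mem⇒< S x x∈S

  nonempty⁺ : (S : Subset n) {x : ℕ} → mem S x ≡ true → isEmptyᵇ S ≡ false
  nonempty⁺ S {x} x∈S with isEmptyᵇ S in e
  ... | false = refl
  ... | true  = bool-clash x∈S (isEmptyᵇ⁻ S e x)

  nonempty⁻ : (S : Subset n) → isEmptyᵇ S ≡ false → ∃ λ x → mem S x ≡ true
  nonempty⁻ S e with member? S
  ... | inj₁ member = member
  ... | inj₂ none   = bool-clash (isEmptyᵇ⁺ S none) e

  ⊆ᵇ⁺ : (A T : Subset n) → A ⊆ T → (A ⊆ᵇ T) ≡ true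
  ⊆ᵇ⁺ A T A⊆T = all≡true⁺ _ (allFinList n) member
    where
    member : ∀ i → (not (lookup A i) ∨ lookup T i) ≡ true
    member i rewrite lookup≡mem A i | lookup≡mem T i with mem A (toℕ i) in i∈A
    ... | false = refl
    ... | true  rewrite A⊆T i∈A = refl

  ⊆ᵇ⁻ : (A T : Subset n) → (A ⊆ᵇ T) ≡ true → A ⊆ T
  ⊆ᵇ⁻ A T e {x} x∈A = member (all≡true⁻ _ e (∈-allFin (fromℕ< x<n)))
    where
    x<n = mem⇒< A x x∈A
    member : (not (lookup A (fromℕ< x<n)) ∨ lookup T (fromℕ< x<n)) ≡ true → mem T x ≡ true
    member h rewrite lookup-fromℕ< A x<n | lookup-fromℕ< T x<n | x∈A = h

  noEdgeBetween⁺ : (A B : Subset n) →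
    (∀ {x y} → mem A x ≡ true → mem B y ≡ true → adjacent x y ≡ false) →
    noEdgeBetween (Psq n) A B ≡ true
  noEdgeBetween⁺ A B h =
    all≡true⁺ _ (allFinList n) λ i → all≡true⁺ _ (allFinList n) λ j → noEdge i j
    where
    noEdge : ∀ i j → not (lookup A i ∧ lookup B j ∧ Psq n i j) ≡ true
    noEdge i j rewrite lookup≡mem A i | lookup≡mem B j
      with mem A (toℕ i) in i∈A | mem B (toℕ j) in j∈B
    ... | false | _     = refl
    ... | true  | false = refl
    ... | true  | true  rewrite h i∈A j∈B = refl

  noEdgeBetween⁻ : (A B : Subset n) → noEdgeBetween (Psq n) A B ≡ true →
    ∀ {x y} → mem A x ≡ true → mem B y ≡ true → adjacent x y ≡ false
  noEdgeBetween⁻ A B e {x} {y} x∈A y∈B =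
    noEdge (all≡true⁻ _ (all≡true⁻ _ e (∈-allFin i)) (∈-allFin j))
    where
    x<n = mem⇒< A x x∈A
    y<n = mem⇒< B y y∈B
    i = fromℕ< x<n
    j = fromℕ< y<n
    noEdge : not (lookup A i ∧ lookup B j ∧ Psq n i j) ≡ true → adjacent x y ≡ false
    noEdge h rewrite lookup-fromℕ< A x<n | lookup-fromℕ< B y<n | toℕ-fromℕ< x<n | toℕ-fromℕ< y<n
                   | x∈A | y∈B = not≡true h

  disjointᵇ⁺ : (F T : Subset n) → (∀ {x} → mem T x ≡ true → mem F x ≡ false) → disjointᵇ F T ≡ true
  disjointᵇ⁺ F T h = isEmptyᵇ⁺ (F ∩ T) λ x → trans (mem-∩ F T x) (disjoint x)
    where
    disjoint : ∀ x → (mem F x ∧ mem T x) ≡ false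
    disjoint x with mem T x in x∈T
    ... | true  rewrite h x∈T = refl
    ... | false = ∧-zeroʳ (mem F x)

  disjointᵇ⁻ : (F T : Subset n) → disjointᵇ F T ≡ true → ∀ {x} → mem T x ≡ true → mem F x ≡ false
  disjointᵇ⁻ F T e {x} x∈T = begin
    mem F x            ≡⟨ sym (∧-identityʳ (mem F x)) ⟩
    mem F x ∧ true     ≡⟨ cong (mem F x ∧_) (sym x∈T) ⟩
    mem F x ∧ mem T x  ≡⟨ sym (mem-∩ F T x) ⟩
    mem (F ∩ T) x      ≡⟨ isEmptyᵇ⁻ (F ∩ T) e x ⟩
    false              ∎
    where open ≡-Reasoning

-- Gaps and disconnectedness

adjacent-suc : ∀ x → adjacent x (1 + x) ≡ true
adjacent-suc zero    = refl
adjacent-suc (suc x) = adjacent-suc x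

adjacent-2+ : ∀ x → adjacent x (2 + x) ≡ true
adjacent-2+ zero    = refl
adjacent-2+ (suc x) = adjacent-2+ x

adjacent-sym : ∀ a b → adjacent a b ≡ adjacent b a
adjacent-sym a b rewrite ℕ.+-comm (a ∸ b) (b ∸ a) = refl

adjacent-far : ∀ {a b} → 3 + a ≤ b → adjacent a b ≡ false
adjacent-far {zero}  {suc zero}          (s≤s ())
adjacent-far {zero}  {suc (suc zero)}    (s≤s (s≤s ()))
adjacent-far {zero}  {suc (suc (suc b))} _             = refl
adjacent-far {suc a} {suc b}             (s≤s a+3≤b)   = adjacent-far a+3≤b

record Gap (T : Subset n) : Set where
  constructor gap
  field
    lo c hi : ℕ
    lo∈T   : mem T lo ≡ true
    hi∈T   : mem T hi ≡ true
    lo≤c   : lo ≤ c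
    c+3≤hi : 3 + c ≤ hi
    1+c∉T  : mem T (1 + c) ≡ false
    2+c∉T  : mem T (2 + c) ≡ false

Gap-∷ : ∀ {b} {T : Subset n} → Gap T → Gap (b ∷ T)
Gap-∷ (gap lo c hi lo∈T hi∈T lo≤c c+3≤hi 1+c∉T 2+c∉T) =
  gap (suc lo) (suc c) (suc hi) lo∈T hi∈T (s≤s lo≤c) (s≤s c+3≤hi) 1+c∉T 2+c∉T

Gap⇒disconnected : (T : Subset n) → Gap T → disconnectedᵇ (Psq n) T ≡ true
Gap⇒disconnected {n} T (gap lo c hi lo∈T hi∈T lo≤c c+3≤hi 1+c∉T 2+c∉T) =
  any≡true⁺ _ (∈-allSubsets A) split
  where
  A = T ∩ atMost c

  A⇒T : ∀ {x} → mem A x ≡ true → mem T x ≡ true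
  A⇒T = mem-∩⁻ˡ T (atMost c)

  A⇒≤c : ∀ {x} → mem A x ≡ true → x ≤ c
  A⇒≤c e = atMost⁻ {n} (mem-∩⁻ʳ T (atMost c) e)

  lo∈A : mem A lo ≡ true
  lo∈A rewrite mem-∩ T (atMost c) lo | lo∈T = atMost⁺ {n} (mem⇒< T lo lo∈T) lo≤c

  hi∉A : mem A hi ≡ false
  hi∉A with mem A hi in e
  ... | false = refl
  ... | true  = contradiction (A⇒≤c e) (ℕ.<⇒≱ (ℕ.≤-trans (ℕ.m≤n+m (suc c) 2) c+3≤hi))

  rest⇒c+3≤ : ∀ {y} → mem (T ─ A) y ≡ true → 3 + c ≤ y
  rest⇒c+3≤ {y} e with y ≤? c
  ... | yes y≤c = bool-clash y∈A (mem-─⁻ʳ T A e)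
    where y∈A = trans (mem-∩ T (atMost c) y)
                      (cong₂ _∧_ (mem-─⁻ˡ T A e) (atMost⁺ {n} (mem⇒< T y (mem-─⁻ˡ T A e)) y≤c))
  ... | no  y≰c = ≤∧∉⇒< T (mem-─⁻ˡ T A e) 2+c∉T (≤∧∉⇒< T (mem-─⁻ˡ T A e) 1+c∉T (ℕ.≰⇒> y≰c))

  split : ((A ⊆ᵇ T) ∧ not (isEmptyᵇ A) ∧ not (isEmptyᵇ (T ─ A))
           ∧ noEdgeBetween (Psq n) A (T ─ A)) ≡ true
  split rewrite ⊆ᵇ⁺ A T A⇒T | nonempty⁺ A lo∈A | nonempty⁺ (T ─ A) (mem-─⁺ T A hi∈T hi∉A)
              | noEdgeBetween⁺ A (T ─ A)
                  (λ x∈A y∈rest → adjacent-far (ℕ.≤-trans (ℕ.+-monoʳ-≤ 3 (A⇒≤c x∈A)) (rest⇒c+3≤ y∈rest)))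
              = refl

gapFree gapFree⁺ : Subset n → Bool
gapFree []          = true
gapFree (false ∷ W) = gapFree W
gapFree (true ∷ W)  = gapFree⁺ W
gapFree⁺ []                 = true
gapFree⁺ (true ∷ W)         = gapFree⁺ W
gapFree⁺ (false ∷ [])       = true
gapFree⁺ (false ∷ true ∷ W) = gapFree⁺ W
gapFree⁺ (false ∷ false ∷ W) = empty? W

Gap⇒gapFree≡false : (W : Subset n) → Gap W → gapFree W ≡ false
Gap⇒gapFree⁺≡false : (W : Subset n) → Gap (true ∷ W) → gapFree⁺ W ≡ false
Gap⇒gapFree≡false (true ∷ W) g = Gap⇒gapFree⁺≡false W g
Gap⇒gapFree≡false (false ∷ W) (gap (suc lo) (suc c) (suc hi) lo∈ hi∈ (s≤s lo≤c) (s≤s c+3≤hi) m₁ m₂) =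
  Gap⇒gapFree≡false W (gap lo c hi lo∈ hi∈ lo≤c c+3≤hi m₁ m₂)
Gap⇒gapFree⁺≡false (true ∷ W) (gap _ (suc c) (suc hi) _ hi∈ _ (s≤s c+3≤hi) m₁ m₂) =
  Gap⇒gapFree⁺≡false W (gap 0 c hi refl hi∈ z≤n c+3≤hi m₁ m₂)
Gap⇒gapFree⁺≡false (false ∷ true ∷ W) (gap _ (suc (suc c)) (suc (suc hi)) _ hi∈ _ (s≤s (s≤s c+3≤hi)) m₁ m₂) =
  Gap⇒gapFree⁺≡false W (gap 0 c hi refl hi∈ z≤n c+3≤hi m₁ m₂)
Gap⇒gapFree⁺≡false (false ∷ false ∷ W) (gap _ _ (suc (suc (suc hi))) _ hi∈ _ _ _ _) =
  empty?≡false⁺ W hi∈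

gapFree≡false⇒Gap : (W : Subset n) → gapFree W ≡ false → Gap W
gapFree⁺≡false⇒Gap : (W : Subset n) → gapFree⁺ W ≡ false → Gap (true ∷ W)
gapFree≡false⇒Gap (true ∷ W)  e = gapFree⁺≡false⇒Gap W e
gapFree≡false⇒Gap (false ∷ W) e = Gap-∷ (gapFree≡false⇒Gap W e)
gapFree⁺≡false⇒Gap (true ∷ W)         e = Gap-∷ (gapFree⁺≡false⇒Gap W e)
gapFree⁺≡false⇒Gap (false ∷ true ∷ W) e = Gap-∷ (Gap-∷ (gapFree⁺≡false⇒Gap W e))
gapFree⁺≡false⇒Gap (false ∷ false ∷ W) e with empty?≡false⁻ W e
... | x , x∈W = gap 0 0 (3 + x) refl x∈W z≤n (s≤s (s≤s (s≤s z≤n))) refl refl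

module _ {n : ℕ} (T S : Subset n) (noGap : ¬ Gap T)
         (closed : ∀ {x y} → mem S x ≡ true → mem T y ≡ true → adjacent x y ≡ true → mem S y ≡ true)
         {t : ℕ} (t∈T : mem T t ≡ true) (t∈S : mem S t ≡ true) where

  -- Without a gap, each member above t has a member of T one or two steps below it.
  closed-above : ∀ e → mem T (e + t) ≡ true → mem S (e + t) ≡ true
  closed-above zero                _   = t∈S
  closed-above (suc zero)          y∈T = closed t∈S y∈T (adjacent-suc t)
  closed-above (suc (suc zero))    y∈T = closed t∈S y∈T (adjacent-2+ t)
  closed-above (suc (suc (suc e))) y∈T = from-below (closed-above (suc (suc e))) (closed-above (suc e))
    where
    from-below : (mem T (2 + e + t) ≡ true → mem S (2 + e + t) ≡ true) →
                 (mem T (1 + e + t) ≡ true → mem S (1 + e + t) ≡ true) → mem S (3 + e + t) ≡ true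
    from-below ih₂ ih₁ with mem T (2 + e + t) in m₂ | mem T (1 + e + t) in m₁
    ... | true  | _     = closed (ih₂ refl) y∈T (adjacent-suc (2 + e + t))
    ... | false | true  = closed (ih₁ refl) y∈T (adjacent-2+ (1 + e + t))
    ... | false | false =
      ⊥-elim (noGap (gap t (e + t) (3 + e + t) t∈T y∈T (ℕ.m≤n+m t e) ℕ.≤-refl m₁ m₂))

  closed-⊇ : (∀ {y} → mem T y ≡ true → t ≤ y) → T ⊆ S
  closed-⊇ t≤ {y} y∈T = subst (λ z → mem S z ≡ true) (ℕ.m∸n+n≡m (t≤ y∈T))
    (closed-above (y ∸ t) (subst (λ z → mem T z ≡ true) (sym (ℕ.m∸n+n≡m (t≤ y∈T))) y∈T))

module _ {n : ℕ} (T A : Subset n) (A⊆T : A ⊆ T) (noEdge : noEdgeBetween (Psq n) A (T ─ A) ≡ true) where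

  private
    noEdge′ : ∀ {x y} → mem A x ≡ true → mem T y ≡ true → mem A y ≡ false → adjacent x y ≡ false
    noEdge′ x∈A y∈T y∉A = noEdgeBetween⁻ A (T ─ A) noEdge x∈A (mem-─⁺ T A y∈T y∉A)

    A-closed : ∀ {x y} → mem A x ≡ true → mem T y ≡ true → adjacent x y ≡ true → mem A y ≡ true
    A-closed {x} {y} x∈A y∈T xy with mem A y in y∈A
    ... | true  = refl
    ... | false = bool-clash xy (noEdge′ x∈A y∈T y∈A)

    rest-closed : ∀ {x y} → mem (T ─ A) x ≡ true → mem T y ≡ true → adjacent x y ≡ true →
                  mem (T ─ A) y ≡ true
    rest-closed {x} {y} x∈rest y∈T xy with mem A y in y∈A
    ... | false = mem-─⁺ T A y∈T y∈A
    ... | true  = bool-clash xy (trans (adjacent-sym x y) (noEdge′ y∈A (mem-─⁻ˡ T A x∈rest) (mem-─⁻ʳ T A x∈rest)))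

  split⇒¬¬Gap : ∀ {a b} → mem A a ≡ true → mem (T ─ A) b ≡ true → ¬ ¬ Gap T
  split⇒¬¬Gap {a} {b} a∈A b∈rest noGap with least T (A⊆T a∈A)
  ... | t , t∈T , t≤ with mem A t in t∈A
  ...   | true  = contradiction (closed-⊇ T A noGap A-closed t∈T t∈A t≤ (mem-─⁻ˡ T A b∈rest))
                                (λ b∈A → bool-clash b∈A (mem-─⁻ʳ T A b∈rest))
  ...   | false = contradiction (closed-⊇ T (T ─ A) noGap rest-closed t∈T (mem-─⁺ T A t∈T t∈A) t≤ (A⊆T a∈A))
                                (λ a∈rest → bool-clash a∈A (mem-─⁻ʳ T A a∈rest))

disconnectedᵇ⁻ : (T : Subset n) → disconnectedᵇ (Psq n) T ≡ true →
  ∃ λ A → A ⊆ T × (∃ λ a → mem A a ≡ true) × (∃ λ b → mem (T ─ A) b ≡ true)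
        × noEdgeBetween (Psq n) A (T ─ A) ≡ true
disconnectedᵇ⁻ {n} T e with any≡true⁻ _ (allSubsets n) e
... | A , split with A ⊆ᵇ T in A⊆T | isEmptyᵇ A in A≠∅ | isEmptyᵇ (T ─ A) in rest≠∅
                   | noEdgeBetween (Psq n) A (T ─ A) in noEdge
...   | true | false | false | true = A , ⊆ᵇ⁻ A T A⊆T , nonempty⁻ A A≠∅ , nonempty⁻ (T ─ A) rest≠∅ , noEdge

disconnected⇒Gap : (T : Subset n) → disconnectedᵇ (Psq n) T ≡ true → Gap T
disconnected⇒Gap T e with gapFree T in free | disconnectedᵇ⁻ T e
... | false | _ = gapFree≡false⇒Gap T free
... | true  | A , A⊆T , (_ , a∈A) , (_ , b∈rest) , noEdge =
  ⊥-elim (split⇒¬¬Gap T A A⊆T noEdge a∈A b∈rest λ g →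
            bool-clash free (Gap⇒gapFree≡false T g))

-- Gapped k-subsets and faces

GappedSubset : ℕ → Subset n → Set
GappedSubset {n} k U = ∃ λ T → T ⊆ U × ∣ T ∣ ≡ k × Gap T

GappedSubset-⊆ : (V U : Subset n) {k : ℕ} → V ⊆ U → GappedSubset k V → GappedSubset k U
GappedSubset-⊆ V U V⊆U (T , T⊆V , ∣T∣≡k , g) = T , (λ x∈T → V⊆U (T⊆V x∈T)) , ∣T∣≡k , g

Gap⇒GappedSubset : (V : Subset n) {k : ℕ} → 2 ≤ k → k ≤ ∣ V ∣ → Gap V → GappedSubset k V
Gap⇒GappedSubset {n} V {k} 2≤k k≤V (gap lo c hi lo∈V hi∈V lo≤c c+3≤hi 1+c∉V 2+c∉V) =
  shrink (extend K V k K⊆V ∣K∣≤k k≤V)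
  where
  K = ⁅ lo ⁆ ∪ ⁅ hi ⁆

  K⊆V : K ⊆ V
  K⊆V {x} x∈K with mem-∪⁻ {n} ⁅ lo ⁆ ⁅ hi ⁆ x∈K
  ... | inj₁ x∈lo = subst (λ z → mem V z ≡ true) (sym (mem-⁅⁆⁻ {n} x∈lo)) lo∈V
  ... | inj₂ x∈hi = subst (λ z → mem V z ≡ true) (sym (mem-⁅⁆⁻ {n} x∈hi)) hi∈V

  ∣K∣≤k : ∣ K ∣ ≤ k
  ∣K∣≤k = ℕ.≤-trans (∣⁅⁆∪⁅⁆∣≤2 {n} lo hi) 2≤k

  shrink : (∃ λ T → K ⊆ T × T ⊆ V × ∣ T ∣ ≡ k) → GappedSubset k V
  shrink (T , K⊆T , T⊆V , ∣T∣≡k) =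
    T , T⊆V , ∣T∣≡k ,
    gap lo c hi (K⊆T (mem-∪⁺ˡ {n} ⁅ lo ⁆ ⁅ hi ⁆ {lo} (mem-⁅⁆⁺ {n} (mem⇒< V lo lo∈V))))
                (K⊆T (mem-∪⁺ʳ {n} ⁅ lo ⁆ ⁅ hi ⁆ {hi} (mem-⁅⁆⁺ {n} (mem⇒< V hi hi∈V))))
                lo≤c c+3≤hi (⊆-∉ T V T⊆V 1+c∉V) (⊆-∉ T V T⊆V 2+c∉V)

window : ℕ → Subset n
window c = ⁅ 1 + c ⁆ ∪ ⁅ 2 + c ⁆

Gap-─window : (U : Subset n) {lo c hi : ℕ} → mem U lo ≡ true → mem U hi ≡ true →
              lo ≤ c → 3 + c ≤ hi → Gap (U ─ window c)
Gap-─window {n} U {lo} {c} {hi} lo∈U hi∈U lo≤c c+3≤hi =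
  gap lo c hi (kept lo∈U (ℕ.<⇒≢ (s≤s lo≤c)) (ℕ.<⇒≢ (ℕ.m≤n⇒m≤1+n (s≤s lo≤c))))
              (kept hi∈U (ℕ.>⇒≢ (ℕ.≤-trans (ℕ.n≤1+n _) c+3≤hi)) (ℕ.>⇒≢ c+3≤hi))
              lo≤c c+3≤hi
              (removed (mem-∪⁺ˡ {n} ⁅ 1 + c ⁆ ⁅ 2 + c ⁆ {1 + c}))
              (removed (mem-∪⁺ʳ {n} ⁅ 1 + c ⁆ ⁅ 2 + c ⁆ {2 + c}))
  where
  kept : ∀ {x} → mem U x ≡ true → x ≢ 1 + c → x ≢ 2 + c → mem (U ─ window c) x ≡ true
  kept {x} x∈U x≢1+c x≢2+c = mem-─⁺ U (window c) x∈U
    (trans (mem-∪ {n} ⁅ 1 + c ⁆ ⁅ 2 + c ⁆ x) (cong₂ _∨_ (mem-⁅⁆-≢ {n} x≢1+c) (mem-⁅⁆-≢ {n} x≢2+c)))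

  removed : ∀ {x} → (mem (⁅_⁆ {n} x) x ≡ true → mem (window {n} c) x ≡ true) → mem (U ─ window c) x ≡ false
  removed into = mem-─-∉ U (window c) λ x∈U → into (mem-⁅⁆⁺ {n} (mem⇒< U _ x∈U))

∣∩window∣≤2 : (U : Subset n) (c : ℕ) → ∣ U ∩ window c ∣ ≤ 2
∣∩window∣≤2 {n} U c =
  ℕ.≤-trans (∣⊆∣ (U ∩ window c) (window c) (mem-∩⁻ʳ U (window c))) (∣⁅⁆∪⁅⁆∣≤2 {n} (1 + c) (2 + c))

∣∩window∣≤1 : (U : Subset n) (c : ℕ) → mem U (1 + c) ≡ false ⊎ mem U (2 + c) ≡ false →
              ∣ U ∩ window c ∣ ≤ 1
∣∩window∣≤1 {n} U c (inj₁ 1+c∉U) = ℕ.≤-trans (∣⊆∣ (U ∩ window c) ⁅ 2 + c ⁆ only) (∣⁅⁆∣≤1 {n} (2 + c))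
  where
  only : (U ∩ window c) ⊆ ⁅ 2 + c ⁆
  only {x} e with mem-∪⁻ {n} ⁅ 1 + c ⁆ ⁅ 2 + c ⁆ (mem-∩⁻ʳ U (window c) e)
  ... | inj₂ x∈ = x∈
  ... | inj₁ x∈ with mem-⁅⁆⁻ {n} x∈
  ...   | refl = bool-clash (mem-∩⁻ˡ U (window c) e) 1+c∉U
∣∩window∣≤1 {n} U c (inj₂ 2+c∉U) = ℕ.≤-trans (∣⊆∣ (U ∩ window c) ⁅ 1 + c ⁆ only) (∣⁅⁆∣≤1 {n} (1 + c))
  where
  only : (U ∩ window c) ⊆ ⁅ 1 + c ⁆
  only {x} e with mem-∪⁻ {n} ⁅ 1 + c ⁆ ⁅ 2 + c ⁆ (mem-∩⁻ʳ U (window c) e)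
  ... | inj₁ x∈ = x∈
  ... | inj₂ x∈ with mem-⁅⁆⁻ {n} x∈
  ...   | refl = bool-clash (mem-∩⁻ˡ U (window c) e) 2+c∉U

window⇒GappedSubset : (U : Subset n) {k lo c hi : ℕ} → 2 ≤ k → k + ∣ U ∩ window c ∣ ≤ ∣ U ∣ →
  mem U lo ≡ true → mem U hi ≡ true → lo ≤ c → 3 + c ≤ hi → GappedSubset k U
window⇒GappedSubset U {k} {c = c} 2≤k room lo∈U hi∈U lo≤c c+3≤hi =
  GappedSubset-⊆ (U ─ window c) U (mem-─⁻ˡ U (window c))
    (Gap⇒GappedSubset (U ─ window c) 2≤k k≤ (Gap-─window U lo∈U hi∈U lo≤c c+3≤hi))
  where
  k≤ : k ≤ ∣ U ─ window c ∣
  k≤ = ℕ.+-cancelʳ-≤ ∣ U ∩ window c ∣ k _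
         (subst (k + ∣ U ∩ window c ∣ ≤_) (sym (∣─∣+∣∩∣ U (window c))) room)

record Hole (U : Subset n) : Set where
  constructor hole
  field
    lo c hi : ℕ
    lo∈U   : mem U lo ≡ true
    hi∈U   : mem U hi ≡ true
    lo≤c   : lo ≤ c
    2+c≤hi : 2 + c ≤ hi
    1+c∉U  : mem U (1 + c) ≡ false

Hole-∷ : ∀ {b} {U : Subset n} → Hole U → Hole (b ∷ U)
Hole-∷ (hole lo c hi lo∈U hi∈U lo≤c 2+c≤hi 1+c∉U) =
  hole (suc lo) (suc c) (suc hi) lo∈U hi∈U (s≤s lo≤c) (s≤s 2+c≤hi) 1+c∉U

interval interval⁺ : Subset n → Bool
interval []          = true
interval (false ∷ U) = interval U
interval (true ∷ U)  = interval⁺ U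
interval⁺ []          = true
interval⁺ (true ∷ U)  = interval⁺ U
interval⁺ (false ∷ U) = empty? U

Hole⇒interval≡false : (U : Subset n) → Hole U → interval U ≡ false
Hole⇒interval⁺≡false : (U : Subset n) → Hole (true ∷ U) → interval⁺ U ≡ false
Hole⇒interval≡false (true ∷ U) h = Hole⇒interval⁺≡false U h
Hole⇒interval≡false (false ∷ U) (hole (suc lo) (suc c) (suc hi) lo∈U hi∈U (s≤s lo≤c) (s≤s 2+c≤hi) 1+c∉U) =
  Hole⇒interval≡false U (hole lo c hi lo∈U hi∈U lo≤c 2+c≤hi 1+c∉U)
Hole⇒interval⁺≡false (true ∷ U) (hole _ (suc c) (suc hi) _ hi∈U _ (s≤s 2+c≤hi) 1+c∉U) =
  Hole⇒interval⁺≡false U (hole 0 c hi refl hi∈U z≤n 2+c≤hi 1+c∉U)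
Hole⇒interval⁺≡false (false ∷ U) (hole _ _ (suc (suc hi)) _ hi∈U _ _ _) = empty?≡false⁺ U hi∈U

interval≡false⇒Hole : (U : Subset n) → interval U ≡ false → Hole U
interval⁺≡false⇒Hole : (U : Subset n) → interval⁺ U ≡ false → Hole (true ∷ U)
interval≡false⇒Hole (true ∷ U)  e = interval⁺≡false⇒Hole U e
interval≡false⇒Hole (false ∷ U) e = Hole-∷ (interval≡false⇒Hole U e)
interval⁺≡false⇒Hole (true ∷ U)  e = Hole-∷ (interval⁺≡false⇒Hole U e)
interval⁺≡false⇒Hole (false ∷ U) e with empty?≡false⁻ U e
... | x , x∈U = hole 0 0 (2 + x) refl x∈U z≤n (s≤s (s≤s z≤n)) refl

-- An interval of k + 1 positions has no gapped k-subset: deleting one position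
-- leaves a hole of width one.
cutFree : ℕ → Subset n → Bool
cutFree k U = (∣ U ∣ <ᵇ k) ∨ ((∣ U ∣ ≡ᵇ k) ∧ gapFree U) ∨ ((∣ U ∣ ≡ᵇ suc k) ∧ interval U)

GappedSubset⇒cutFree≡false : (U : Subset n) {k : ℕ} → GappedSubset k U → cutFree k U ≡ false
GappedSubset⇒cutFree≡false U (T , T⊆U , refl , gap lo c hi lo∈T hi∈T lo≤c c+3≤hi 1+c∉T 2+c∉T) =
  cong₂ _∨_ (<ᵇ-false (ℕ.≤⇒≯ (∣⊆∣ T U T⊆U)))
            (cong₂ _∨_ (∧≡false sameSize) (∧≡false oneMore))
  where
  lo∈U = T⊆U lo∈T
  hi∈U = T⊆U hi∈T

  sameSize : (∣ U ∣ ≡ᵇ ∣ T ∣) ≡ true → gapFree U ≡ false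
  sameSize e = Gap⇒gapFree≡false U (gap lo c hi lo∈U hi∈U lo≤c c+3≤hi (∉U 1+c∉T) (∉U 2+c∉T))
    where
    ∉U : ∀ {x} → mem T x ≡ false → mem U x ≡ false
    ∉U {x} x∉T with mem U x in x∈U
    ... | false = refl
    ... | true  = contradiction (∣⊂∣ T U T⊆U x∈U x∉T) (ℕ.<-irrefl (sym (≡ᵇ≡true⇒≡ e)))

  oneMore : (∣ U ∣ ≡ᵇ suc ∣ T ∣) ≡ true → interval U ≡ false
  oneMore e with mem U (1 + c) in 1+c∈U | mem U (2 + c) in 2+c∈U
  ... | false | _     = Hole⇒interval≡false U (hole lo c hi lo∈U hi∈U lo≤c (ℕ.<⇒≤ c+3≤hi) 1+c∈U)
  ... | true  | false = Hole⇒interval≡false U (hole lo (1 + c) hi lo∈U hi∈U (ℕ.m≤n⇒m≤1+n lo≤c) c+3≤hi 2+c∈U)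
  ... | true  | true  = contradiction (∣⊂∣₂ T U T⊆U ℕ.≤-refl 1+c∈U 1+c∉T 2+c∈U 2+c∉T)
                                      (ℕ.<-irrefl (sym (≡ᵇ≡true⇒≡ e)))

oneMissing⇒GappedSubset : (U : Subset n) {k lo c hi : ℕ} → 2 ≤ k → ∣ U ∣ ≡ suc k →
  mem U lo ≡ true → mem U hi ≡ true → lo ≤ c → 3 + c ≤ hi →
  mem U (1 + c) ≡ false ⊎ mem U (2 + c) ≡ false → GappedSubset k U
oneMissing⇒GappedSubset U {k} {c = c} 2≤k ∣U∣≡1+k lo∈U hi∈U lo≤c c+3≤hi missing =
  window⇒GappedSubset U 2≤k room lo∈U hi∈U lo≤c c+3≤hi
  where
  room : k + ∣ U ∩ window c ∣ ≤ ∣ U ∣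
  room = subst (k + ∣ U ∩ window c ∣ ≤_) (sym ∣U∣≡1+k)
           (ℕ.≤-trans (ℕ.+-monoʳ-≤ k (∣∩window∣≤1 U c missing)) (ℕ.≤-reflexive (ℕ.+-comm k 1)))

-- The hole 1 + c lies in the window {c, 1 + c} or {1 + c, 2 + c}; as ∣ U ∣ ≥ 3,
-- one of them has members of U on both sides.
Hole⇒GappedSubset : (U : Subset n) {k : ℕ} → 2 ≤ k → ∣ U ∣ ≡ suc k → Hole U → GappedSubset k U
Hole⇒GappedSubset {n} U {k} 2≤k ∣U∣≡1+k (hole lo c hi lo∈U hi∈U lo≤c 2+c≤hi 1+c∉U) with 3 + c ≤? hi
... | yes 3+c≤hi = oneMissing⇒GappedSubset U 2≤k ∣U∣≡1+k lo∈U hi∈U lo≤c 3+c≤hi (inj₁ 1+c∉U)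
... | no 3+c≰hi with ℕ.≤-antisym 2+c≤hi (ℕ.≤-pred (ℕ.≰⇒> 3+c≰hi))
...   | refl with lo <? c
...     | yes (s≤s lo≤c′) = oneMissing⇒GappedSubset U 2≤k ∣U∣≡1+k lo∈U hi∈U lo≤c′ ℕ.≤-refl (inj₂ 1+c∉U)
...     | no lo≮c with ℕ.≤-antisym lo≤c (ℕ.≮⇒≥ lo≮c)
...       | refl with ∃-outside (⁅ lo ⁆ ∪ ⁅ 2 + lo ⁆) U
                       (subst (_ <_) (sym ∣U∣≡1+k) (s≤s (ℕ.≤-trans (∣⁅⁆∪⁅⁆∣≤2 {n} lo (2 + lo)) 2≤k)))
...         | x , x∈U , x∉ends with ℕ.<-cmp x lo
...           | tri< (s≤s x≤c′) _ _ = oneMissing⇒GappedSubset U 2≤k ∣U∣≡1+k x∈U hi∈U x≤c′ ℕ.≤-refl (inj₂ 1+c∉U)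
...           | tri≈ _ x≡lo _ =
  contradiction x≡lo (mem-⁅⁆≡false⇒≢ (mem⇒< U x x∈U) (proj₁ (mem-∪≡false⁻ {n} ⁅ lo ⁆ ⁅ 2 + lo ⁆ x∉ends)))
...           | tri> _ _ lo<x = oneMissing⇒GappedSubset U 2≤k ∣U∣≡1+k lo∈U x∈U ℕ.≤-refl 3+lo≤x (inj₁ 1+c∉U)
  where
  3+lo≤x : 3 + lo ≤ x
  3+lo≤x = ℕ.≤∧≢⇒< (≤∧∉⇒< U x∈U 1+c∉U lo<x)
                   (≢-sym (mem-⁅⁆≡false⇒≢ (mem⇒< U x x∈U) (proj₂ (mem-∪≡false⁻ {n} ⁅ lo ⁆ ⁅ 2 + lo ⁆ x∉ends))))

beyond-window : ∀ {t j} → t ≤ j → j < n → mem (⁅_⁆ {n} t ∪ window t) j ≡ false → 3 + t ≤ j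
beyond-window {n} {t} {j} t≤j j<n j∉ =
  ℕ.≤∧≢⇒< (ℕ.≤∧≢⇒< (ℕ.≤∧≢⇒< t≤j (≢-sym (mem-⁅⁆≡false⇒≢ j<n j∉t))) (≢-sym (mem-⁅⁆≡false⇒≢ j<n j∉1+t)))
          (≢-sym (mem-⁅⁆≡false⇒≢ j<n j∉2+t))
  where
  j∉t    = proj₁ (mem-∪≡false⁻ {n} ⁅ t ⁆ (window t) j∉)
  j∉W    = proj₂ (mem-∪≡false⁻ {n} ⁅ t ⁆ (window t) j∉)
  j∉1+t  = proj₁ (mem-∪≡false⁻ {n} ⁅ 1 + t ⁆ ⁅ 2 + t ⁆ j∉W)
  j∉2+t  = proj₂ (mem-∪≡false⁻ {n} ⁅ 1 + t ⁆ ⁅ 2 + t ⁆ j∉W)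

-- Remove the two positions after the least member t; some member of U lies beyond them.
big⇒GappedSubset : (U : Subset n) {k : ℕ} → 2 ≤ k → 2 + k ≤ ∣ U ∣ → GappedSubset k U
big⇒GappedSubset {n} U {k} 2≤k 2+k≤U = fromLeast (least U (proj₁ (proj₂ (∃-outside ⊥ U ∣⊥∣<∣U∣))))
  where
  4≤∣U∣ : 4 ≤ ∣ U ∣
  4≤∣U∣ = ℕ.≤-trans (ℕ.+-monoʳ-≤ 2 2≤k) 2+k≤U

  ∣⊥∣<∣U∣ : ∣ ⊥ {n} ∣ < ∣ U ∣
  ∣⊥∣<∣U∣ = subst (_< ∣ U ∣) (sym (∣⊥∣≡0 n)) (ℕ.≤-trans (s≤s z≤n) 4≤∣U∣)

  room : ∀ t → k + ∣ U ∩ window t ∣ ≤ ∣ U ∣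
  room t = ℕ.≤-trans (ℕ.+-monoʳ-≤ k (∣∩window∣≤2 U t)) (subst (_≤ ∣ U ∣) (ℕ.+-comm 2 k) 2+k≤U)

  ∣⁅⁆∪window∣≤3 : ∀ t → ∣ ⁅_⁆ {n} t ∪ window t ∣ ≤ 3
  ∣⁅⁆∪window∣≤3 t = ℕ.≤-trans (∣∪∣≤ {n} ⁅ t ⁆ (window t))
                              (ℕ.+-mono-≤ (∣⁅⁆∣≤1 {n} t) (∣⁅⁆∪⁅⁆∣≤2 {n} (1 + t) (2 + t)))

  fromLeast : (∃ λ t → mem U t ≡ true × ∀ {y} → mem U y ≡ true → t ≤ y) → GappedSubset k U
  fromLeast (t , t∈U , t≤) with ∃-outside (⁅ t ⁆ ∪ window t) U (ℕ.≤-trans (s≤s (∣⁅⁆∪window∣≤3 t)) 4≤∣U∣)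
  ... | j , j∈U , j∉X =
    window⇒GappedSubset U 2≤k (room t) t∈U j∈U ℕ.≤-refl (beyond-window (t≤ j∈U) (mem⇒< U j j∈U) j∉X)

cutFree≡false⇒GappedSubset : (U : Subset n) {k : ℕ} → 2 ≤ k → cutFree k U ≡ false → GappedSubset k U
cutFree≡false⇒GappedSubset U {k} 2≤k e = bySize (∨-conicalˡ _ _ e) (∨-conicalˡ _ _ e′) (∨-conicalʳ _ _ e′)
  where
  e′ = ∨-conicalʳ (∣ U ∣ <ᵇ k) _ e

  bySize : (∣ U ∣ <ᵇ k) ≡ false → ((∣ U ∣ ≡ᵇ k) ∧ gapFree U) ≡ false →
           ((∣ U ∣ ≡ᵇ suc k) ∧ interval U) ≡ false → GappedSubset k U
  bySize small sameSize oneMore with ∣ U ∣ ≟ k | ∣ U ∣ ≟ suc k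
  ... | yes ∣U∣≡k | _ =
    U , (λ x∈U → x∈U) , ∣U∣≡k , gapFree≡false⇒Gap U (∧≡false⁻ sameSize (≡ᵇ-true ∣U∣≡k))
  ... | no _ | yes ∣U∣≡1+k =
    Hole⇒GappedSubset U 2≤k ∣U∣≡1+k
      (interval≡false⇒Hole U (∧≡false⁻ oneMore (≡ᵇ-true ∣U∣≡1+k)))
  ... | no ∣U∣≢k | no ∣U∣≢1+k =
    big⇒GappedSubset U 2≤k (ℕ.≤∧≢⇒< (ℕ.≤∧≢⇒< k≤∣U∣ (≢-sym ∣U∣≢k)) (≢-sym ∣U∣≢1+k))
    where
    k≤∣U∣ : k ≤ ∣ U ∣
    k≤∣U∣ = ℕ.≮⇒≥ λ ∣U∣<k → bool-clash (<ᵇ-true ∣U∣<k) small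

GappedSubset⇒face : (F : Subset n) {k : ℕ} → GappedSubset k (∁ F) → cutComplex (Psq n) k F ≡ true
GappedSubset⇒face {n} F {k} (T , T⊆∁F , ∣T∣≡k , g) = any≡true⁺ _ (∈-allSubsets T) facet
  where
  facet : ((∣ T ∣ ≡ᵇ k) ∧ disconnectedᵇ (Psq n) T ∧ disjointᵇ F T) ≡ true
  facet rewrite ≡ᵇ-true ∣T∣≡k | Gap⇒disconnected T g
              | disjointᵇ⁺ F T (λ x∈T → ∁⁻ F (T⊆∁F x∈T)) = refl

face⇒GappedSubset : (F : Subset n) {k : ℕ} → cutComplex (Psq n) k F ≡ true → GappedSubset k (∁ F)
face⇒GappedSubset {n} F {k} face with any≡true⁻ _ (allSubsets n) face
... | T , facet =
  T , (λ {x} x∈T → ∁⁺ F (mem⇒< T x x∈T) (disjointᵇ⁻ F T disjoint x∈T)) ,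
  ≡ᵇ≡true⇒≡ (∧-conicalˡ _ _ facet) , disconnected⇒Gap T (∧-conicalˡ _ _ rest)
  where
  rest = ∧-conicalʳ (∣ T ∣ ≡ᵇ k) _ facet
  disjoint = ∧-conicalʳ (disconnectedᵇ (Psq n) T) _ rest

cutComplex≡not-cutFree : {k : ℕ} → 2 ≤ k → (F : Subset n) → cutComplex (Psq n) k F ≡ not (cutFree k (∁ F))
cutComplex≡not-cutFree {n} {k} 2≤k F with cutFree k (∁ F) in free
... | false = GappedSubset⇒face F (cutFree≡false⇒GappedSubset (∁ F) 2≤k free)
... | true with cutComplex (Psq n) k F in face
...   | false = refl
...   | true  = bool-clash free (GappedSubset⇒cutFree≡false (∁ F) (face⇒GappedSubset F face))

sign : ℕ → ℤ
sign m = -1ℤ ℤ.^ m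

sign-+ : ∀ a b → sign (a + b) ≡ sign a ℤ.* sign b
sign-+ = ℤₚ.^-distribˡ-+-* -1ℤ

sign-square : ∀ a → sign a ℤ.* sign a ≡ 1ℤ
sign-square zero    = refl
sign-square (suc a) = trans (square-neg (sign a)) (sign-square a)
  where
  square-neg : ∀ x → (-1ℤ ℤ.* x) ℤ.* (-1ℤ ℤ.* x) ≡ x ℤ.* x
  square-neg = ℤ-Ring.solve-∀

sign-∁ : (U : Subset n) → sign ∣ ∁ U ∣ ≡ sign n ℤ.* sign ∣ U ∣
sign-∁ {n} U = begin
  sign ∣ ∁ U ∣                                  ≡⟨ times-square (sign ∣ ∁ U ∣) ⟩
  sign ∣ ∁ U ∣ ℤ.* sign ∣ U ∣ ℤ.* sign ∣ U ∣    ≡⟨ cong (ℤ._* sign ∣ U ∣) (sym (sign-+ ∣ ∁ U ∣ ∣ U ∣)) ⟩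
  sign (∣ ∁ U ∣ + ∣ U ∣) ℤ.* sign ∣ U ∣         ≡⟨ cong (λ m → sign m ℤ.* sign ∣ U ∣) ∣∁U∣+∣U∣≡n ⟩
  sign n ℤ.* sign ∣ U ∣                          ∎
  where
  open ≡-Reasoning
  ∣∁U∣+∣U∣≡n : ∣ ∁ U ∣ + ∣ U ∣ ≡ n
  ∣∁U∣+∣U∣≡n = trans (cong (_+ ∣ U ∣) (∣∁p∣≡n∸∣p∣ U)) (ℕ.m∸n+n≡m (∣p∣≤n U))
  times-square : ∀ x → x ≡ x ℤ.* sign ∣ U ∣ ℤ.* sign ∣ U ∣
  times-square x = trans (sym (ℤₚ.*-identityʳ x))
                         (trans (cong (x ℤ.*_) (sym (sign-square ∣ U ∣))) (sym (ℤₚ.*-assoc x _ _)))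

sumSubsets : (n : ℕ) → (Subset n → ℤ) → ℤ
sumSubsets zero    f = f []
sumSubsets (suc n) f = sumSubsets n (f ∘ (true ∷_)) ℤ.+ sumSubsets n (f ∘ (false ∷_))

sumℤ-++ : (xs ys : List ℤ) → sumℤ (xs ++ ys) ≡ sumℤ xs ℤ.+ sumℤ ys
sumℤ-++ []       ys = sym (ℤₚ.+-identityˡ _)
sumℤ-++ (x ∷ xs) ys = trans (cong (ℤ._+_ x) (sumℤ-++ xs ys)) (sym (ℤₚ.+-assoc x _ _))

sumℤ-allSubsets : (f : Subset n → ℤ) → sumℤ (map f (allSubsets n)) ≡ sumSubsets n f
sumℤ-allSubsets {zero}  f = ℤₚ.+-identityʳ (f [])
sumℤ-allSubsets {suc n} f = begin
  sumℤ (map f (map (true ∷_) S ++ map (false ∷_) S))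
    ≡⟨ cong sumℤ (map-++ f (map (true ∷_) S) _) ⟩
  sumℤ (map f (map (true ∷_) S) ++ map f (map (false ∷_) S))
    ≡⟨ sumℤ-++ (map f (map (true ∷_) S)) _ ⟩
  sumℤ (map f (map (true ∷_) S)) ℤ.+ sumℤ (map f (map (false ∷_) S))
    ≡⟨ cong₂ (λ xs ys → sumℤ xs ℤ.+ sumℤ ys) (sym (map-∘ S)) (sym (map-∘ S)) ⟩
  sumℤ (map (f ∘ (true ∷_)) S) ℤ.+ sumℤ (map (f ∘ (false ∷_)) S)
    ≡⟨ cong₂ ℤ._+_ (sumℤ-allSubsets (f ∘ (true ∷_))) (sumℤ-allSubsets (f ∘ (false ∷_))) ⟩
  sumSubsets (suc n) f ∎
  where
  open ≡-Reasoning
  S = allSubsets n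

sumℤ-filter : {A : Set} (P : A → Bool) (g : A → ℤ) (xs : List A) →
  sumℤ (map g (filter (λ x → P x Bool.≟ true) xs)) ≡ sumℤ (map (λ x → if P x then g x else 0ℤ) xs)
sumℤ-filter P g []       = refl
sumℤ-filter P g (x ∷ xs) with P x
... | true  = cong (ℤ._+_ (g x)) (sumℤ-filter P g xs)
... | false = trans (sumℤ-filter P g xs) (sym (ℤₚ.+-identityˡ _))

redEuler≡sumSubsets : (Δ : Complex n) → redEuler Δ ≡ sumSubsets n (λ F → if Δ F then signPred ∣ F ∣ else 0ℤ)
redEuler≡sumSubsets {n} Δ = trans (sumℤ-filter Δ (signPred ∘ ∣_∣) (allSubsets n)) (sumℤ-allSubsets {n} _)

sumSubsets-cong : ∀ n {f g : Subset n → ℤ} → (∀ U → f U ≡ g U) → sumSubsets n f ≡ sumSubsets n g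
sumSubsets-cong zero    f≗g = f≗g []
sumSubsets-cong (suc n) f≗g =
  cong₂ ℤ._+_ (sumSubsets-cong n (f≗g ∘ (true ∷_))) (sumSubsets-cong n (f≗g ∘ (false ∷_)))

sumSubsets-∁ : ∀ n (f : Subset n → ℤ) → sumSubsets n f ≡ sumSubsets n (f ∘ ∁)
sumSubsets-∁ zero    f = refl
sumSubsets-∁ (suc n) f =
  trans (cong₂ ℤ._+_ (sumSubsets-∁ n (f ∘ (true ∷_))) (sumSubsets-∁ n (f ∘ (false ∷_))))
        (ℤₚ.+-comm (sumSubsets n (λ U → f (true ∷ ∁ U))) _)

sumSubsets-+ : ∀ n (f g : Subset n → ℤ) →
  sumSubsets n (λ U → f U ℤ.+ g U) ≡ sumSubsets n f ℤ.+ sumSubsets n g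
sumSubsets-+ zero    f g = refl
sumSubsets-+ (suc n) f g =
  trans (cong₂ ℤ._+_ (sumSubsets-+ n (f ∘ (true ∷_)) (g ∘ (true ∷_)))
                     (sumSubsets-+ n (f ∘ (false ∷_)) (g ∘ (false ∷_))))
        (+ℤ-interchange (sumSubsets n (f ∘ (true ∷_))) (sumSubsets n (g ∘ (true ∷_))) _ _)

sumSubsets-*ˡ : ∀ n (c : ℤ) (f : Subset n → ℤ) → sumSubsets n (λ U → c ℤ.* f U) ≡ c ℤ.* sumSubsets n f
sumSubsets-*ˡ zero    c f = refl
sumSubsets-*ˡ (suc n) c f =
  trans (cong₂ ℤ._+_ (sumSubsets-*ˡ n c (f ∘ (true ∷_))) (sumSubsets-*ˡ n c (f ∘ (false ∷_))))
        (sym (ℤₚ.*-distribˡ-+ c _ _))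

sumSubsets-zero : ∀ n → sumSubsets n (λ _ → 0ℤ) ≡ 0ℤ
sumSubsets-zero zero    = refl
sumSubsets-zero (suc n) = cong₂ ℤ._+_ (sumSubsets-zero n) (sumSubsets-zero n)

sumSubsets-sign : ∀ n → sumSubsets (suc n) (λ U → sign ∣ U ∣) ≡ 0ℤ
sumSubsets-sign n =
  trans (cong (ℤ._+ S) (trans (sumSubsets-*ˡ n -1ℤ (λ U → sign ∣ U ∣)) (ℤₚ.-1*i≡-i S))) (ℤₚ.+-inverseˡ S)
  where S = sumSubsets n (λ U → sign ∣ U ∣)

count : (n : ℕ) → (Subset n → Bool) → ℕ
count zero    P = if P [] then 1 else 0
count (suc n) P = count n (P ∘ (true ∷_)) + count n (P ∘ (false ∷_))

count-cong : ∀ n {P Q : Subset n → Bool} → (∀ U → P U ≡ Q U) → count n P ≡ count n Q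
count-cong zero    P≗Q = cong (λ b → if b then 1 else 0) (P≗Q [])
count-cong (suc n) P≗Q = cong₂ _+_ (count-cong n (P≗Q ∘ (true ∷_))) (count-cong n (P≗Q ∘ (false ∷_)))

count-false : ∀ n → count n (λ _ → false) ≡ 0
count-false zero    = refl
count-false (suc n) = cong₂ _+_ (count-false n) (count-false n)

sumSubsets-if : ∀ n (P : Subset n → Bool) (c : ℤ) →
  sumSubsets n (λ U → if P U then c else 0ℤ) ≡ c ℤ.* + count n P
sumSubsets-if zero P c with P []
... | true  = sym (ℤₚ.*-identityʳ c)
... | false = sym (ℤₚ.*-zeroʳ c)
sumSubsets-if (suc n) P c =
  trans (cong₂ ℤ._+_ (sumSubsets-if n (P ∘ (true ∷_)) c) (sumSubsets-if n (P ∘ (false ∷_)) c))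
        (sym (ℤₚ.*-distribˡ-+ c (+ count n (P ∘ (true ∷_))) _))

-- Counting gap-free sets and intervals

#sized : (n k : ℕ) → (Subset n → Bool) → ℕ
#sized n k P = count n (λ U → (∣ U ∣ ≡ᵇ k) ∧ P U)

#sized-0 : ∀ n (P : Subset n → Bool) → #sized n 0 P ≡ (if P ⊥ then 1 else 0)
#sized-0 zero    P = refl
#sized-0 (suc n) P = cong₂ _+_ (count-false n) (#sized-0 n (P ∘ (false ∷_)))

#sized-empty?-suc : ∀ n k → #sized n (suc k) empty? ≡ 0
#sized-empty?-suc zero    k = refl
#sized-empty?-suc (suc n) k =
  cong₂ _+_ (trans (count-cong n (λ U → ∧-zeroʳ (∣ U ∣ ≡ᵇ k))) (count-false n)) (#sized-empty?-suc n k)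

∑< : ℕ → (ℕ → ℕ) → ℕ
∑< zero    f = 0
∑< (suc m) f = f 0 + ∑< m (f ∘ suc)

∑<-cong : ∀ m {f g : ℕ → ℕ} → (∀ j → f j ≡ g j) → ∑< m f ≡ ∑< m g
∑<-cong zero    f≗g = refl
∑<-cong (suc m) f≗g = cong₂ _+_ (f≗g 0) (∑<-cong m (f≗g ∘ suc))

∑<-zero : ∀ m (f : ℕ → ℕ) → (∀ j → f j ≡ 0) → ∑< m f ≡ 0
∑<-zero zero    f f≗0 = refl
∑<-zero (suc m) f f≗0 = cong₂ _+_ (f≗0 0) (∑<-zero m (f ∘ suc) (f≗0 ∘ suc))

∑<-+ : ∀ m (f g : ℕ → ℕ) → ∑< m (λ j → f j + g j) ≡ ∑< m f + ∑< m g
∑<-+ zero    f g = refl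
∑<-+ (suc m) f g = trans (cong (_+_ (f 0 + g 0)) (∑<-+ m (f ∘ suc) (g ∘ suc))) (+-interchange (f 0) (g 0) _ _)

∑<-last : ∀ m (f : ℕ → ℕ) → ∑< (suc m) f ≡ ∑< m f + f m
∑<-last zero    f = ℕ.+-comm (f 0) 0
∑<-last (suc m) f = trans (cong (_+_ (f 0)) (∑<-last m (f ∘ suc))) (sym (ℕ.+-assoc (f 0) _ _))

∑<-pascal : ∀ k (h : ℕ → ℕ) →
  ∑< (2 + k) (λ j → (suc k C j) * h j) ≡ ∑< (suc k) (λ j → (k C j) * h j) + ∑< (suc k) (λ j → (k C j) * h (suc j))
∑<-pascal k h = begin
  h 0 + 0 + ∑< (suc k) (λ j → (suc k C suc j) * h (suc j))
    ≡⟨ cong (_+_ (h 0 + 0)) (∑<-cong (suc k) pascal) ⟩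
  h 0 + 0 + ∑< (suc k) (λ j → (k C j) * h (suc j) + (k C suc j) * h (suc j))
    ≡⟨ cong (_+_ (h 0 + 0)) (∑<-+ (suc k) (λ j → (k C j) * h (suc j)) (λ j → (k C suc j) * h (suc j))) ⟩
  h 0 + 0 + (A + ∑< (suc k) (λ j → (k C suc j) * h (suc j)))
    ≡⟨ cong (λ z → h 0 + 0 + (A + z)) (∑<-last k (λ j → (k C suc j) * h (suc j))) ⟩
  h 0 + 0 + (A + (B + (k C suc k) * h (suc k)))
    ≡⟨ cong (λ z → h 0 + 0 + (A + (B + z * h (suc k)))) (k>n⇒nCk≡0 (ℕ.n<1+n k)) ⟩
  h 0 + 0 + (A + (B + 0))
    ≡⟨ rearrange (h 0) A B ⟩
  h 0 + 0 + B + A ∎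
  where
  open ≡-Reasoning
  A = ∑< (suc k) (λ j → (k C j) * h (suc j))
  B = ∑< k (λ j → (k C suc j) * h (suc j))
  pascal : ∀ j → (suc k C suc j) * h (suc j) ≡ (k C j) * h (suc j) + (k C suc j) * h (suc j)
  pascal j = trans (cong (_* h (suc j)) (sym (nCk+nC[k+1]≡[n+1]C[k+1] k j))) (ℕ.*-distribʳ-+ (h (suc j)) ((k C j)) _)
  rearrange : ∀ a b c → a + 0 + (b + (c + 0)) ≡ a + 0 + c + b
  rearrange = ℕ-Ring.solve-∀

[_≤_] : ℕ → ℕ → ℕ
[ zero  ≤ _     ] = 1
[ suc _ ≤ zero  ] = 0
[ suc m ≤ suc n ] = [ m ≤ n ]

∸-suc : ∀ m n → suc n ∸ m ≡ [ m ≤ n ] + (n ∸ m)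
∸-suc zero    n       = refl
∸-suc (suc m) zero    = ℕ.0∸n≡0 m
∸-suc (suc m) (suc n) = ∸-suc m n

gapFree⁺-⊥ : ∀ n → gapFree⁺ (⊥ {n}) ≡ true
gapFree⁺-⊥ zero          = refl
gapFree⁺-⊥ (suc zero)    = refl
gapFree⁺-⊥ (suc (suc n)) = empty?-⊥ n

-- A gap-free set containing position 0 is fixed by which of its k successive
-- differences are 2 rather than 1; with j of them it spans k + j + 1 positions.
#sized-gapFree⁺ : ∀ n k → #sized n k gapFree⁺ ≡ ∑< (suc k) (λ j → (k C j) * [ k + j ≤ n ])
#sized-gapFree⁺ n             zero          =
  trans (#sized-0 n gapFree⁺) (cong (λ b → if b then 1 else 0) (gapFree⁺-⊥ n))
#sized-gapFree⁺ zero          (suc k)       = sym (∑<-zero (2 + k) _ λ j → ℕ.*-zeroʳ (suc k C j))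
#sized-gapFree⁺ (suc zero)    (suc zero)    = refl
#sized-gapFree⁺ (suc zero)    (suc (suc k)) = sym (∑<-zero (3 + k) _ λ j → ℕ.*-zeroʳ (suc (suc k) C j))
#sized-gapFree⁺ (suc (suc n)) (suc k)       = begin
  #sized (suc n) k gapFree⁺ + (#sized n k gapFree⁺ + #sized n (suc k) empty?)
    ≡⟨ cong₂ (λ a b → a + (b + #sized n (suc k) empty?)) (#sized-gapFree⁺ (suc n) k) (#sized-gapFree⁺ n k) ⟩
  G (suc n) + (G n + #sized n (suc k) empty?)
    ≡⟨ cong (λ z → G (suc n) + (G n + z)) (#sized-empty?-suc n k) ⟩
  G (suc n) + (G n + 0)
    ≡⟨ cong (_+_ (G (suc n))) (ℕ.+-identityʳ (G n)) ⟩
  G (suc n) + G n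
    ≡⟨ cong (_+_ (G (suc n))) (∑<-cong (suc k) λ j → cong (λ t → (k C j) * [ t ≤ suc n ]) (sym (ℕ.+-suc k j))) ⟩
  G (suc n) + ∑< (suc k) (λ j → (k C j) * [ k + suc j ≤ suc n ])
    ≡⟨ sym (∑<-pascal k (λ j → [ suc k + j ≤ 2 + n ])) ⟩
  ∑< (2 + k) (λ j → (suc k C j) * [ suc k + j ≤ 2 + n ]) ∎
  where
  open ≡-Reasoning
  G : ℕ → ℕ
  G m = ∑< (suc k) (λ j → (k C j) * [ k + j ≤ m ])

#sized-gapFree : ∀ n k → #sized n (suc k) gapFree ≡ ∑< (suc k) (λ j → (k C j) * (n ∸ (k + j)))
#sized-gapFree zero    k =
  sym (∑<-zero (suc k) _ λ j → trans (cong ((k C j) *_) (ℕ.0∸n≡0 (k + j))) (ℕ.*-zeroʳ (k C j)))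
#sized-gapFree (suc n) k = begin
  #sized n k gapFree⁺ + #sized n (suc k) gapFree
    ≡⟨ cong₂ _+_ (#sized-gapFree⁺ n k) (#sized-gapFree n k) ⟩
  ∑< (suc k) (λ j → (k C j) * [ k + j ≤ n ]) + ∑< (suc k) (λ j → (k C j) * (n ∸ (k + j)))
    ≡⟨ sym (∑<-+ (suc k) (λ j → (k C j) * [ k + j ≤ n ]) (λ j → (k C j) * (n ∸ (k + j)))) ⟩
  ∑< (suc k) (λ j → (k C j) * [ k + j ≤ n ] + (k C j) * (n ∸ (k + j)))
    ≡⟨ ∑<-cong (suc k) (λ j → trans (sym (ℕ.*-distribˡ-+ (k C j) [ k + j ≤ n ] (n ∸ (k + j))))
                                    (cong ((k C j) *_) (sym (∸-suc (k + j) n)))) ⟩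
  ∑< (suc k) (λ j → (k C j) * (suc n ∸ (k + j))) ∎
  where open ≡-Reasoning

interval⁺-⊥ : ∀ n → interval⁺ (⊥ {n}) ≡ true
interval⁺-⊥ zero    = refl
interval⁺-⊥ (suc n) = empty?-⊥ n

#sized-interval⁺ : ∀ n k → #sized n k interval⁺ ≡ [ k ≤ n ]
#sized-interval⁺ n       zero    = trans (#sized-0 n interval⁺) (cong (λ b → if b then 1 else 0) (interval⁺-⊥ n))
#sized-interval⁺ zero    (suc k) = refl
#sized-interval⁺ (suc n) (suc k) =
  trans (cong₂ _+_ (#sized-interval⁺ n k) (#sized-empty?-suc n k)) (ℕ.+-identityʳ _)

#sized-interval : ∀ n k → #sized n (suc k) interval ≡ n ∸ k
#sized-interval zero    k = sym (ℕ.0∸n≡0 k)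
#sized-interval (suc n) k = trans (cong₂ _+_ (#sized-interval⁺ n k) (#sized-interval n k)) (sym (∸-suc k n))

signedBelow : (n k : ℕ) → ℤ
signedBelow n k = sumSubsets n (λ U → if ∣ U ∣ <ᵇ k then sign ∣ U ∣ else 0ℤ)

signedBelow-suc : ∀ n k → signedBelow (suc n) (suc k) ≡ -1ℤ ℤ.* signedBelow n k ℤ.+ signedBelow n (suc k)
signedBelow-suc n k =
  cong (ℤ._+ signedBelow n (suc k))
       (trans (sumSubsets-cong n (λ U → pull (∣ U ∣ <ᵇ k) (sign ∣ U ∣))) (sumSubsets-*ˡ n -1ℤ _))
  where
  pull : ∀ b x → (if b then -1ℤ ℤ.* x else 0ℤ) ≡ -1ℤ ℤ.* (if b then x else 0ℤ)
  pull true  x = refl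
  pull false x = refl

signedBelow-closed : ∀ n k → signedBelow (suc n) (suc k) ≡ sign k ℤ.* + (n C k)
signedBelow-closed zero    zero    = refl
signedBelow-closed zero    (suc k) = sym (ℤₚ.*-zeroʳ (sign (suc k)))
signedBelow-closed (suc n) zero    =
  trans (signedBelow-suc (suc n) 0)
        (cong₂ (λ a b → -1ℤ ℤ.* a ℤ.+ b) (sumSubsets-zero (suc n)) (signedBelow-closed n 0))
signedBelow-closed (suc n) (suc k) = begin
  signedBelow (2 + n) (2 + k)
    ≡⟨ signedBelow-suc (suc n) (suc k) ⟩
  -1ℤ ℤ.* signedBelow (suc n) (suc k) ℤ.+ signedBelow (suc n) (suc (suc k))
    ≡⟨ cong₂ (λ a b → -1ℤ ℤ.* a ℤ.+ b) (signedBelow-closed n k) (signedBelow-closed n (suc k)) ⟩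
  -1ℤ ℤ.* (sign k ℤ.* + (n C k)) ℤ.+ sign (suc k) ℤ.* + (n C suc k)
    ≡⟨ factor (sign k) (+ (n C k)) (+ (n C suc k)) ⟩
  sign (suc k) ℤ.* + ((n C k) + (n C suc k))
    ≡⟨ cong (λ m → sign (suc k) ℤ.* + m) (nCk+nC[k+1]≡[n+1]C[k+1] n k) ⟩
  sign (suc k) ℤ.* + (suc n C suc k) ∎
  where
  open ≡-Reasoning
  factor : ∀ s a b → -1ℤ ℤ.* (s ℤ.* a) ℤ.+ (-1ℤ ℤ.* s) ℤ.* b ≡ (-1ℤ ℤ.* s) ℤ.* (a ℤ.+ b)
  factor = ℤ-Ring.solve-∀

-- The reduced Euler characteristic

-- The three disjuncts of cutFree exclude each other.
cutFree-weight : ∀ k (U : Subset n) →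
  (if cutFree k U then sign ∣ U ∣ else 0ℤ)
  ≡ (if ∣ U ∣ <ᵇ k then sign ∣ U ∣ else 0ℤ)
    ℤ.+ ((if (∣ U ∣ ≡ᵇ k) ∧ gapFree U then sign k else 0ℤ)
    ℤ.+ (if (∣ U ∣ ≡ᵇ suc k) ∧ interval U then sign (suc k) else 0ℤ))
cutFree-weight k U with ℕ.<-cmp ∣ U ∣ k
... | tri< ∣U∣<k _ _ rewrite <ᵇ-true ∣U∣<k | ≡ᵇ-false (ℕ.<⇒≢ ∣U∣<k) | ≡ᵇ-false (ℕ.<⇒≢ (ℕ.m<n⇒m<1+n ∣U∣<k)) =
  sym (ℤₚ.+-identityʳ _)
... | tri≈ _ refl _ rewrite <ᵇ-false (ℕ.<-irrefl (refl {x = ∣ U ∣})) | ≡ᵇ-true (refl {x = ∣ U ∣})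
                          | ≡ᵇ-false (ℕ.<⇒≢ (ℕ.n<1+n ∣ U ∣)) with gapFree U
...   | true  = sym (trans (ℤₚ.+-identityˡ _) (ℤₚ.+-identityʳ _))
...   | false = refl
cutFree-weight k U | tri> _ _ k<∣U∣ with ∣ U ∣ ≟ suc k
... | no ∣U∣≢1+k rewrite <ᵇ-false (ℕ.<⇒≯ k<∣U∣) | ≡ᵇ-false (ℕ.>⇒≢ k<∣U∣) | ≡ᵇ-false ∣U∣≢1+k = refl
... | yes ∣U∣≡1+k rewrite <ᵇ-false (ℕ.<⇒≯ k<∣U∣) | ≡ᵇ-false (ℕ.>⇒≢ k<∣U∣) | ≡ᵇ-true ∣U∣≡1+k with interval U
...   | true  = trans (cong sign ∣U∣≡1+k) (sym (trans (ℤₚ.+-identityˡ _) (ℤₚ.+-identityˡ _)))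
...   | false = refl

sumSubsets-cutFree : ∀ n k →
  sumSubsets n (λ U → if cutFree k U then sign ∣ U ∣ else 0ℤ)
  ≡ signedBelow n k ℤ.+ (sign k ℤ.* + #sized n k gapFree ℤ.+ sign (suc k) ℤ.* + #sized n (suc k) interval)
sumSubsets-cutFree n k = begin
  sumSubsets n (λ U → if cutFree k U then sign ∣ U ∣ else 0ℤ)
    ≡⟨ sumSubsets-cong n (cutFree-weight k) ⟩
  sumSubsets n (λ U → A U ℤ.+ (B U ℤ.+ C U))
    ≡⟨ sumSubsets-+ n A (λ U → B U ℤ.+ C U) ⟩
  signedBelow n k ℤ.+ sumSubsets n (λ U → B U ℤ.+ C U)
    ≡⟨ cong (ℤ._+_ (signedBelow n k)) (sumSubsets-+ n B C) ⟩
  signedBelow n k ℤ.+ (sumSubsets n B ℤ.+ sumSubsets n C)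
    ≡⟨ cong (ℤ._+_ (signedBelow n k))
            (cong₂ ℤ._+_ (sumSubsets-if n (λ U → (∣ U ∣ ≡ᵇ k) ∧ gapFree U) (sign k))
                         (sumSubsets-if n (λ U → (∣ U ∣ ≡ᵇ suc k) ∧ interval U) (sign (suc k)))) ⟩
  signedBelow n k ℤ.+ (sign k ℤ.* + #sized n k gapFree ℤ.+ sign (suc k) ℤ.* + #sized n (suc k) interval) ∎
  where
  open ≡-Reasoning
  A B C : Subset n → ℤ
  A U = if ∣ U ∣ <ᵇ k then sign ∣ U ∣ else 0ℤ
  B U = if (∣ U ∣ ≡ᵇ k) ∧ gapFree U then sign k else 0ℤ
  C U = if (∣ U ∣ ≡ᵇ suc k) ∧ interval U then sign (suc k) else 0ℤ

-- Passing to complements U = ∁ F turns (-1)^(|F|-1) into -(-1)^n (-1)^|U|,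
-- and the full alternating sum over all U vanishes.
redEuler-cutComplex : ∀ n {k} → 2 ≤ k →
  redEuler (cutComplex (Psq (suc n)) k)
  ≡ sign (suc n) ℤ.* sumSubsets (suc n) (λ U → if cutFree k U then sign ∣ U ∣ else 0ℤ)
redEuler-cutComplex n {k} 2≤k = begin
  redEuler Δ
    ≡⟨ redEuler≡sumSubsets Δ ⟩
  sumSubsets N (λ F → if Δ F then signPred ∣ F ∣ else 0ℤ)
    ≡⟨ sumSubsets-∁ N (λ F → if Δ F then signPred ∣ F ∣ else 0ℤ) ⟩
  sumSubsets N (λ U → if Δ (∁ U) then signPred ∣ ∁ U ∣ else 0ℤ)
    ≡⟨ sumSubsets-cong N complement ⟩
  sumSubsets N (λ U → sign N ℤ.* w U ℤ.+ (ℤ.- sign N) ℤ.* sign ∣ U ∣)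
    ≡⟨ sumSubsets-+ N (λ U → sign N ℤ.* w U) (λ U → (ℤ.- sign N) ℤ.* sign ∣ U ∣) ⟩
  sumSubsets N (λ U → sign N ℤ.* w U) ℤ.+ sumSubsets N (λ U → (ℤ.- sign N) ℤ.* sign ∣ U ∣)
    ≡⟨ cong₂ ℤ._+_ (sumSubsets-*ˡ N (sign N) w)
                   (trans (sumSubsets-*ˡ N (ℤ.- sign N) (λ U → sign ∣ U ∣))
                          (cong (ℤ._*_ (ℤ.- sign N)) (sumSubsets-sign n))) ⟩
  sign N ℤ.* sumSubsets N w ℤ.+ (ℤ.- sign N) ℤ.* 0ℤ
    ≡⟨ trans (cong (ℤ._+_ (sign N ℤ.* sumSubsets N w)) (ℤₚ.*-zeroʳ (ℤ.- sign N))) (ℤₚ.+-identityʳ _) ⟩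
  sign N ℤ.* sumSubsets N w ∎
  where
  open ≡-Reasoning
  N = suc n
  Δ = cutComplex (Psq N) k
  w : Subset N → ℤ
  w U = if cutFree k U then sign ∣ U ∣ else 0ℤ

  flip : ∀ b s u → (if not b then ℤ.- (s ℤ.* u) else 0ℤ) ≡ s ℤ.* (if b then u else 0ℤ) ℤ.+ (ℤ.- s) ℤ.* u
  flip true  s u = sym (cancel s u)
    where cancel : ∀ s u → s ℤ.* u ℤ.+ (ℤ.- s) ℤ.* u ≡ 0ℤ
          cancel = ℤ-Ring.solve-∀
  flip false s u = only s u
    where only : ∀ s u → ℤ.- (s ℤ.* u) ≡ s ℤ.* 0ℤ ℤ.+ (ℤ.- s) ℤ.* u
          only = ℤ-Ring.solve-∀

  complement : ∀ U → (if Δ (∁ U) then signPred ∣ ∁ U ∣ else 0ℤ) ≡ sign N ℤ.* w U ℤ.+ (ℤ.- sign N) ℤ.* sign ∣ U ∣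
  complement U = begin
    (if Δ (∁ U) then signPred ∣ ∁ U ∣ else 0ℤ)
      ≡⟨ cong (λ b → if b then signPred ∣ ∁ U ∣ else 0ℤ) (cutComplex≡not-cutFree 2≤k (∁ U)) ⟩
    (if not (cutFree k (∁ (∁ U))) then ℤ.- sign ∣ ∁ U ∣ else 0ℤ)
      ≡⟨ cong₂ (λ V z → if not (cutFree k V) then ℤ.- z else 0ℤ) (∁-involutive U) (sign-∁ U) ⟩
    (if not (cutFree k U) then ℤ.- (sign N ℤ.* sign ∣ U ∣) else 0ℤ)
      ≡⟨ flip (cutFree k U) (sign N) (sign ∣ U ∣) ⟩
    sign N ℤ.* w U ℤ.+ (ℤ.- sign N) ℤ.* sign ∣ U ∣ ∎

sumℤ-applyUpTo : ∀ m (f : ℕ → ℕ) (g : ℕ → ℤ) (h : ℕ → ℕ) →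
  (∀ j → j < m → g (f j) ≡ + h j) → sumℤ (map g (applyUpTo f m)) ≡ + ∑< m h
sumℤ-applyUpTo zero    f g h g≗h = refl
sumℤ-applyUpTo (suc m) f g h g≗h =
  cong₂ ℤ._+_ (g≗h 0 (s≤s z≤n)) (sumℤ-applyUpTo m (f ∘ suc) g (h ∘ suc) λ j j<m → g≗h (suc j) (s≤s j<m))

∑<-truncate : ∀ a d (f : ℕ → ℕ) → (∀ j → a ≤ j → f j ≡ 0) → ∑< (a + d) f ≡ ∑< a f
∑<-truncate zero    d f f≥a≡0 = ∑<-zero d f λ j → f≥a≡0 j z≤n
∑<-truncate (suc a) d f f≥a≡0 = cong (_+_ (f 0)) (∑<-truncate a d (f ∘ suc) λ j a≤j → f≥a≡0 (suc j) (s≤s a≤j))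

-- Beyond j = r the terms vanish, so the sum may stop at k′ ⊓ r.
sum-upTo-⊓≡∑< : ∀ k′ r →
  sumℤ (map (λ j → + (k′ C j) ℤ.* (+ r ℤ.- + j ℤ.+ + 1)) (upTo (suc (k′ ⊓ r))))
  ≡ + ∑< (suc k′) (λ j → (k′ C j) * (suc (k′ + r) ∸ (k′ + j)))
sum-upTo-⊓≡∑< k′ r =
  trans (sumℤ-applyUpTo (suc (k′ ⊓ r)) (λ j → j) _ h
                        (λ j j≤min → term j (ℕ.≤-trans (ℕ.≤-pred j≤min) (ℕ.m⊓n≤n k′ r))))
        (cong +_ truncated)
  where
  h : ℕ → ℕ
  h j = (k′ C j) * (suc (k′ + r) ∸ (k′ + j))

  positions : ∀ {j} → j ≤ r → r ∸ j + 1 ≡ suc (k′ + r) ∸ (k′ + j)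
  positions {j} j≤r = begin
    r ∸ j + 1                   ≡⟨ ℕ.+-comm (r ∸ j) 1 ⟩
    suc (r ∸ j)                 ≡⟨ sym (ℕ.+-∸-assoc 1 j≤r) ⟩
    suc r ∸ j                   ≡⟨ sym (ℕ.[m+n]∸[m+o]≡n∸o k′ (suc r) j) ⟩
    k′ + suc r ∸ (k′ + j)       ≡⟨ cong (_∸ (k′ + j)) (ℕ.+-suc k′ r) ⟩
    suc (k′ + r) ∸ (k′ + j)     ∎
    where open ≡-Reasoning

  term : ∀ j → j ≤ r → + (k′ C j) ℤ.* (+ r ℤ.- + j ℤ.+ + 1) ≡ + h j
  term j j≤r = begin
    + (k′ C j) ℤ.* (+ r ℤ.- + j ℤ.+ + 1)
      ≡⟨ cong (λ z → + (k′ C j) ℤ.* (z ℤ.+ + 1)) (trans (ℤₚ.m-n≡m⊖n r j) (ℤₚ.⊖-≥ j≤r)) ⟩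
    + (k′ C j) ℤ.* + (r ∸ j + 1)           ≡⟨ sym (ℤₚ.pos-* (k′ C j) _) ⟩
    + ((k′ C j) * (r ∸ j + 1))             ≡⟨ cong (λ z → + ((k′ C j) * z)) (positions j≤r) ⟩
    + h j                                  ∎
    where open ≡-Reasoning

  truncated : ∑< (suc (k′ ⊓ r)) h ≡ ∑< (suc k′) h
  truncated with k′ ≤? r
  ... | yes k′≤r = cong (λ m → ∑< (suc m) h) (ℕ.m≤n⇒m⊓n≡m k′≤r)
  ... | no  k′≰r = begin
    ∑< (suc (k′ ⊓ r)) h            ≡⟨ cong (λ m → ∑< (suc m) h) (ℕ.m≥n⇒m⊓n≡n r≤k′) ⟩
    ∑< (suc r) h                   ≡⟨ sym (∑<-truncate (suc r) (k′ ∸ r) h beyond) ⟩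
    ∑< (suc r + (k′ ∸ r)) h        ≡⟨ cong (λ m → ∑< (suc m) h) (ℕ.m+[n∸m]≡n r≤k′) ⟩
    ∑< (suc k′) h                  ∎
    where
    open ≡-Reasoning
    r≤k′ = ℕ.<⇒≤ (ℕ.≰⇒> k′≰r)
    beyond : ∀ j → suc r ≤ j → h j ≡ 0
    beyond j r<j = trans (cong ((k′ C j) *_) (ℕ.m≤n⇒m∸n≡0 (subst (_≤ k′ + j) (ℕ.+-suc k′ r) (ℕ.+-monoʳ-≤ k′ r<j))))
                         (ℕ.*-zeroʳ (k′ C j))

sign-bookkeeping : ∀ k′ r₀ (a g ρ : ℤ) →
  sign (suc (k′ + suc (suc r₀))) ℤ.* (sign k′ ℤ.* a ℤ.+ (sign (suc k′) ℤ.* g ℤ.+ sign (2 + k′) ℤ.* ρ))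
  ≡ sign (suc r₀) ℤ.* ((a ℤ.- g) ℤ.+ ρ)
sign-bookkeeping k′ r₀ a g ρ = begin
  -1ℤ ℤ.* sign (k′ + r) ℤ.* X
    ≡⟨ cong (λ s → -1ℤ ℤ.* s ℤ.* X) (sign-+ k′ r) ⟩
  -1ℤ ℤ.* (s ℤ.* (-1ℤ ℤ.* t)) ℤ.* (s ℤ.* a ℤ.+ ((-1ℤ ℤ.* s) ℤ.* g ℤ.+ (-1ℤ ℤ.* (-1ℤ ℤ.* s)) ℤ.* ρ))
    ≡⟨ regroup s t a g ρ ⟩
  s ℤ.* s ℤ.* (t ℤ.* ((a ℤ.- g) ℤ.+ ρ))
    ≡⟨ cong (ℤ._* (t ℤ.* ((a ℤ.- g) ℤ.+ ρ))) (sign-square k′) ⟩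
  1ℤ ℤ.* (t ℤ.* ((a ℤ.- g) ℤ.+ ρ))
    ≡⟨ ℤₚ.*-identityˡ _ ⟩
  t ℤ.* ((a ℤ.- g) ℤ.+ ρ) ∎
  where
  open ≡-Reasoning
  r = suc (suc r₀)
  s = sign k′
  t = sign (suc r₀)
  X = sign k′ ℤ.* a ℤ.+ (sign (suc k′) ℤ.* g ℤ.+ sign (2 + k′) ℤ.* ρ)
  regroup : ∀ s t a g ρ →
    -1ℤ ℤ.* (s ℤ.* (-1ℤ ℤ.* t)) ℤ.* (s ℤ.* a ℤ.+ ((-1ℤ ℤ.* s) ℤ.* g ℤ.+ (-1ℤ ℤ.* (-1ℤ ℤ.* s)) ℤ.* ρ))
    ≡ s ℤ.* s ℤ.* (t ℤ.* ((a ℤ.- g) ℤ.+ ρ))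
  regroup = ℤ-Ring.solve-∀

redEuler-closed-form : ∀ n′ k′ r → k′ + r ≡ n′ → 1 ≤ k′ → 2 ≤ r →
  redEuler (cutComplex (Psq (suc n′)) (suc k′))
  ≡ sign (r ∸ 1) ℤ.* ((+ (n′ C k′) ℤ.- sumℤ (map (λ j → + (k′ C j) ℤ.* (+ r ℤ.- + j ℤ.+ + 1)) (upTo (suc (k′ ⊓ r)))))
                     ℤ.+ + r)
redEuler-closed-form _ k′ r@(suc (suc r₀)) refl 1≤k′ (s≤s (s≤s z≤n)) = begin
  redEuler (cutComplex (Psq N) k)
    ≡⟨ redEuler-cutComplex (k′ + r) (s≤s 1≤k′) ⟩
  sign N ℤ.* sumSubsets N (λ U → if cutFree k U then sign ∣ U ∣ else 0ℤ)
    ≡⟨ cong (sign N ℤ.*_) (trans (sumSubsets-cutFree N k) counts) ⟩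
  sign N ℤ.* (sign k′ ℤ.* Cnk ℤ.+ (sign k ℤ.* + G ℤ.+ sign (suc k) ℤ.* + r))
    ≡⟨ sign-bookkeeping k′ r₀ Cnk (+ G) (+ r) ⟩
  sign (suc r₀) ℤ.* ((Cnk ℤ.- + G) ℤ.+ + r)
    ≡⟨ cong (λ z → sign (suc r₀) ℤ.* ((Cnk ℤ.- z) ℤ.+ + r)) (sym (sum-upTo-⊓≡∑< k′ r)) ⟩
  sign (suc r₀) ℤ.* ((Cnk ℤ.- sumℤ (map (λ j → + (k′ C j) ℤ.* (+ r ℤ.- + j ℤ.+ + 1)) (upTo (suc (k′ ⊓ r)))))
                     ℤ.+ + r) ∎
  where
  open ≡-Reasoning
  N = suc (k′ + r)
  k = suc k′
  Cnk = + ((k′ + r) C k′)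
  G = ∑< (suc k′) (λ j → (k′ C j) * (N ∸ (k′ + j)))
  counts : signedBelow N k ℤ.+ (sign k ℤ.* + #sized N k gapFree ℤ.+ sign (suc k) ℤ.* + #sized N (suc k) interval)
           ≡ sign k′ ℤ.* Cnk ℤ.+ (sign k ℤ.* + G ℤ.+ sign (suc k) ℤ.* + r)
  counts = cong₂ ℤ._+_ (signedBelow-closed (k′ + r) k′)
                       (cong₂ (λ a b → sign k ℤ.* + a ℤ.+ sign (suc k) ℤ.* + b)
                              (#sized-gapFree N k′) (trans (#sized-interval N k) (ℕ.m+n∸m≡n k′ r)))

proposition4p3 : (n k : ℕ) → 2 ≤ k → k + 2 ≤ n →
    redEuler (cutComplex (Psq n) k)
      ≡ (-[1+ 0 ] ℤ.^ ((n ∸ k) ∸ 1))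
        ℤ.* ((+ ((n ∸ 1) C (k ∸ 1))
              ℤ.- sumℤ (map (λ j → + ((k ∸ 1) C j) ℤ.* (+ (n ∸ k) ℤ.- + j ℤ.+ + 1))
                            (upTo (suc ((k ∸ 1) ⊓ (n ∸ k))))))
             ℤ.+ + (n ∸ k))
proposition4p3 (suc n′) (suc k′) (s≤s 1≤k′) (s≤s k′+2≤n′) =
  redEuler-closed-form n′ k′ (n′ ∸ k′) (ℕ.m+[n∸m]≡n k′≤n′) 1≤k′ 2≤n′∸k′
  where
  k′≤n′ : k′ ≤ n′
  k′≤n′ = ℕ.≤-trans (ℕ.m≤m+n k′ 2) k′+2≤n′
  2≤n′∸k′ : 2 ≤ n′ ∸ k′
  2≤n′∸k′ = subst (_≤ n′ ∸ k′) (ℕ.m+n∸m≡n k′ 2) (ℕ.∸-monoˡ-≤ k′ k′+2≤n′)
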